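{- Let $A\in\mathbb{F}_2[x]$ be a nonconstant odd perfect polynomial. Then $$\phi(A)=\sum_{D\mid A,\ D\neq 1,\ D\neq A}\sigma(D)\,\phi\!\left(\frac{A}{D}\right).$$
   Context: A nonzero $A\in\mathbb{F}_2[x]$ is odd if it has no irreducible factor of degree $1$. $\sigma(A)$ is the sum of all divisors of $A$ in $\mathbb{F}_2[x]$, and $A$ is perfect if $\sigma(A)=A$. $\phi$ is the multiplicative function on $\mathbb{F}_2[x]\setminus\{0\}$ (i.e. $\phi(AB)=\phi(A)\phi(B)$ when $\gcd(A,B)=1$, $\phi(1)=1$) defined by $\phi(P^r)=P^r+P^{r-1}$ for $P$ irreducible and $r\ge 1$. Sums over $D\mid A$ run over all divisors of $A$ in $\mathbb{F}_2[x]$. -}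

module Defs where

open import Data.Bool using (Bool; true; false; not; _xor_; if_then_else_)
open import Data.Nat using (ℕ; zero; suc)
open import Data.List using (List; []; _∷_; map; concatMap; filter; foldr; _++_)
open import Data.Product using (_×_; _,_; proj₁; proj₂; Σ; ∃)
open import Data.Sum using (_⊎_)
open import Relation.Nullary using (¬_; Dec; yes; no; ¬?)
open import Relation.Nullary.Decidable using (_×-dec_)
open import Relation.Binary.PropositionalEquality using (_≡_; refl; cong; cong₂)

-- Polynomials over F₂ with a canonical (unique) representation.
-- Coefficient lists, lowest degree first, with leading coefficient 1.

-- Nonzero polynomials: 'one' is the constant 1, 'b ∷⁺ p' is b + x·p.
data Poly⁺ : Set where
  one  : Poly⁺
  _∷⁺_ : Bool → Poly⁺ → Poly⁺

infixr 5 _∷⁺_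

data Poly : Set where
  𝟘   : Poly
  ⟨_⟩ : Poly⁺ → Poly

𝟙 : Poly
𝟙 = ⟨ one ⟩

X : Poly
X = ⟨ false ∷⁺ one ⟩

cons : Bool → Poly → Poly
cons false 𝟘     = 𝟘
cons true  𝟘     = ⟨ one ⟩
cons b     ⟨ p ⟩ = ⟨ b ∷⁺ p ⟩

add⁺ : Poly⁺ → Poly⁺ → Poly
add⁺ one      one      = 𝟘
add⁺ one      (b ∷⁺ q) = ⟨ not b ∷⁺ q ⟩
add⁺ (a ∷⁺ p) one      = ⟨ not a ∷⁺ p ⟩
add⁺ (a ∷⁺ p) (b ∷⁺ q) = cons (a xor b) (add⁺ p q)

infixl 6 _+_
infixl 7 _*_
infixr 8 _^_

_+_ : Poly → Poly → Poly
𝟘     + q     = q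
⟨ p ⟩ + 𝟘     = ⟨ p ⟩
⟨ p ⟩ + ⟨ q ⟩ = add⁺ p q

mul⁺ : Poly⁺ → Poly → Poly
mul⁺ one      q = q
mul⁺ (b ∷⁺ p) q = (if b then q else 𝟘) + cons false (mul⁺ p q)

_*_ : Poly → Poly → Poly
𝟘     * q = 𝟘
⟨ p ⟩ * q = mul⁺ p q

_^_ : Poly → ℕ → Poly
p ^ zero  = 𝟙
p ^ suc n = p * p ^ n

-- degree (deg 0 := 0 by convention; only used for nonzero polynomials)
deg⁺ : Poly⁺ → ℕ
deg⁺ one      = zero
deg⁺ (_ ∷⁺ p) = suc (deg⁺ p)

deg : Poly → ℕ
deg 𝟘     = zero
deg ⟨ p ⟩ = deg⁺ p

infix 4 _≟⁺_ _≟_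

private
  ∷⁺-inj₁ : ∀ {a b p q} → a ∷⁺ p ≡ b ∷⁺ q → a ≡ b
  ∷⁺-inj₁ refl = refl
  ∷⁺-inj₂ : ∀ {a b p q} → a ∷⁺ p ≡ b ∷⁺ q → p ≡ q
  ∷⁺-inj₂ refl = refl
  ⟨⟩-inj : ∀ {p q} → ⟨ p ⟩ ≡ ⟨ q ⟩ → p ≡ q
  ⟨⟩-inj refl = refl

_≟B_ : (a b : Bool) → Dec (a ≡ b)
false ≟B false = yes refl
false ≟B true  = no λ ()
true  ≟B false = no λ ()
true  ≟B true  = yes refl

_≟⁺_ : (p q : Poly⁺) → Dec (p ≡ q)
one      ≟⁺ one      = yes refl
one      ≟⁺ (_ ∷⁺ _) = no λ ()
(_ ∷⁺ _) ≟⁺ one      = no λ ()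
(a ∷⁺ p) ≟⁺ (b ∷⁺ q) with a ≟B b | p ≟⁺ q
... | yes refl | yes refl = yes refl
... | no a≢b   | _        = no λ e → a≢b (∷⁺-inj₁ e)
... | yes _    | no p≢q   = no λ e → p≢q (∷⁺-inj₂ e)

_≟_ : (p q : Poly) → Dec (p ≡ q)
𝟘     ≟ 𝟘     = yes refl
𝟘     ≟ ⟨ _ ⟩ = no λ ()
⟨ _ ⟩ ≟ 𝟘     = no λ ()
⟨ p ⟩ ≟ ⟨ q ⟩ with p ≟⁺ q
... | yes refl = yes refl
... | no p≢q   = no λ e → p≢q (⟨⟩-inj e)

infix 4 _∣_
_∣_ : Poly → Poly → Set
D ∣ A = ∃ λ Q → A ≡ D * Q

-- P irreducible: nonzero, not a unit (the only unit of F₂[x] is 1),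
-- and every factorisation P = B·C has a unit factor.
Irreducible : Poly → Set
Irreducible P = ¬ (P ≡ 𝟘) × ¬ (P ≡ 𝟙) × (∀ B C → P ≡ B * C → B ≡ 𝟙 ⊎ C ≡ 𝟙)

Coprime : Poly → Poly → Set
Coprime A B = ∀ D → D ∣ A → D ∣ B → D ≡ 𝟙

Odd : Poly → Set
Odd A = ¬ (A ≡ 𝟘) × (∀ P → Irreducible P → deg P ≡ 1 → ¬ (P ∣ A))

polys⁺≤ : ℕ → List Poly⁺
polys⁺≤ zero    = one ∷ []
polys⁺≤ (suc n) = one ∷ (map (false ∷⁺_) (polys⁺≤ n) ++ map (true ∷⁺_) (polys⁺≤ n))

polys≤ : ℕ → List Poly
polys≤ n = 𝟘 ∷ map ⟨_⟩ (polys⁺≤ n)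

-- all pairs (D , Q) with D·Q = A.  For A ≠ 0 any such D, Q have degree
-- ≤ deg A, so this lists every divisor D of A exactly once, paired with
-- its cofactor Q = A / D.
divPairs : Poly → List (Poly × Poly)
divPairs A =
  filter (λ dq → (proj₁ dq * proj₂ dq) ≟ A)
         (concatMap (λ D → map (λ Q → D , Q) (polys≤ (deg A))) (polys≤ (deg A)))

sumP : List Poly → Poly
sumP = foldr _+_ 𝟘

σ : Poly → Poly
σ A = sumP (map proj₁ (divPairs A))

Perfect : Poly → Set
Perfect A = σ A ≡ A

properDivisorSum : (Poly → Poly) → Poly → Poly
properDivisorSum φ A =
  sumP (map (λ dq → σ (proj₁ dq) * φ (proj₂ dq))
            (filter (λ dq → ¬? (proj₁ dq ≟ 𝟙) ×-dec ¬? (proj₁ dq ≟ A)) (divPairs A)))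

-- φ: the multiplicative function with φ(P^r) = P^r + P^(r-1).
-- (Such a function is uniquely determined on nonzero polynomials.)

record IsPhi (φ : Poly → Poly) : Set where
  field
    φ-one   : φ 𝟙 ≡ 𝟙
    φ-mult  : ∀ A B → ¬ (A ≡ 𝟘) → ¬ (B ≡ 𝟘) → Coprime A B → φ (A * B) ≡ φ A * φ B
    φ-prime : ∀ P r → Irreducible P → φ (P ^ suc r) ≡ P ^ suc r + P ^ r

-- Write (σ ⊛ φ) A = Σ_{D ∣ A} σ(D) φ(A / D).  As σ and φ are multiplicative, so is σ ⊛ φ.  On a
-- prime power it satisfies (σ ⊛ φ)(P ^ (e + 1)) = P ^ (e + 1) + P · (σ ⊛ φ)(P ^ e) in characteristic 2,
-- so it equals P ^ e for even e and 0 for odd e.  For odd e, however, 1 + P divides σ(P ^ e), and x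
-- divides P or 1 + P; so if x divides neither A nor σ(A) = A, all exponents of A are even and
-- (σ ⊛ φ) A = A.  The terms D = 1 and D = A contribute φ(A) + A, and the identity follows since -1 = 1.
module Submission where

open import Defs
open import Algebra.Bundles using (CommutativeMonoid)
import Algebra.Properties.CommutativeSemigroup as CommutativeSemigroupProperties
open import Algebra.Structures using (IsCommutativeMonoid)
open import Algebra.Structures.Biased using (isCommutativeMonoidˡ)
open import Data.Bool using (Bool; true; false; not; _xor_; if_then_else_)
open import Data.Bool.Properties using (xor-comm; xor-assoc; xor-same)
open import Data.Empty using (⊥-elim)
open import Data.List using (List; []; _∷_; map; filter; _++_; cartesianProduct; concatMap)
open import Data.List.Membership.Propositional using (_∈_; find; lose)
open import Data.List.Membership.Propositional.Properties
  using (∈-map⁺; ∈-map⁻; ∈-++⁺ˡ; ∈-++⁺ʳ; ∈-filter⁺; ∈-filter⁻; ∈-cartesianProduct⁺; ∈-cartesianProduct⁻)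
open import Data.List.Membership.Propositional.Properties.WithK using (unique∧set⇒bag)
open import Data.List.Properties using (map-∘; map-cong-local)
open import Data.List.Relation.Binary.BagAndSetEquality using (_∼[_]_; set; ∼bag⇒↭)
open import Data.List.Relation.Binary.Permutation.Propositional using (_↭_; ↭⇒↭ₛ)
import Data.List.Relation.Binary.Permutation.Propositional.Properties as ↭
open import Data.List.Relation.Unary.All as All using (All; []; _∷_)
import Data.List.Relation.Unary.All.Properties as All
open import Data.List.Relation.Unary.AllPairs using ([]; _∷_)
open import Data.List.Relation.Unary.Any using (here; there; any?)
open import Data.List.Relation.Unary.Unique.Propositional using (Unique)
import Data.List.Relation.Unary.Unique.Propositional.Properties as Unique
open import Data.Nat using (ℕ; zero; suc; _≤_; _<_; z≤n; s≤s) renaming (_+_ to _+ℕ_)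
open import Data.Nat.Induction using (<-wellFounded)
open import Data.Nat.Properties
  using ( ≤-refl; ≤-trans; ≤-<-trans; suc-injective; <-irrefl; m≤n+m; m≤m+n; m<m+n
        ; m≤n⇒m<n∨m≡n; n≢0⇒n>0; m+n≡0⇒m≡0; +-suc)
  renaming (+-identityʳ to +ℕ-identityʳ)
open import Data.Product using (_×_; _,_; proj₁; proj₂; ∃-syntax; uncurry; map₂)
open import Data.Sum using (_⊎_; inj₁; inj₂)
open import Function using (_∘_; id; const; _⇔_; mk⇔; Equivalence)
import Function.Properties.Equivalence as ⇔
import Induction.WellFounded as WF
open import Level using (0ℓ)
import Relation.Binary.Construct.On as On
open import Relation.Binary.PropositionalEquality
  using ( _≡_; _≢_; refl; sym; trans; cong; cong₂; subst; subst₂; isEquivalence; setoid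
        ; module ≡-Reasoning)
open import Relation.Nullary using (¬_; Dec; yes; no; ¬?)
open import Relation.Nullary.Decidable using (_×-dec_)
open import Relation.Unary using (Decidable)
open import Relation.Unary.Properties using (∁?)

open import Data.List.Relation.Binary.Permutation.Setoid.Properties (setoid Poly)
  using (foldr-commMonoid)

open ≡-Reasoning

-- The ring 𝔽₂[x]

head : Poly → Bool
head 𝟘             = false
head ⟨ one ⟩        = true
head ⟨ b ∷⁺ _ ⟩     = b

tail : Poly → Poly
tail 𝟘             = 𝟘
tail ⟨ one ⟩        = 𝟘
tail ⟨ _ ∷⁺ p ⟩     = ⟨ p ⟩

cons-head-tail : ∀ p → cons (head p) (tail p) ≡ p
cons-head-tail 𝟘              = refl
cons-head-tail ⟨ one ⟩         = refl
cons-head-tail ⟨ false ∷⁺ p ⟩  = refl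
cons-head-tail ⟨ true ∷⁺ p ⟩   = refl

cons-induction : (P : Poly → Set) → P 𝟘 → (∀ b p → P p → P (cons b p)) → ∀ p → P p
cons-induction P P𝟘 Pcons 𝟘     = P𝟘
cons-induction P P𝟘 Pcons ⟨ p ⟩ = go p
  where
  go : ∀ p → P ⟨ p ⟩
  go one          = Pcons true 𝟘 P𝟘
  go (false ∷⁺ p) = Pcons false ⟨ p ⟩ (go p)
  go (true ∷⁺ p)  = Pcons true ⟨ p ⟩ (go p)

+-identityʳ : ∀ p → p + 𝟘 ≡ p
+-identityʳ 𝟘     = refl
+-identityʳ ⟨ p ⟩ = refl

cons-+ : ∀ a b p q → cons a p + cons b q ≡ cons (a xor b) (p + q)
cons-+ false false 𝟘     _     = refl
cons-+ false true  𝟘     _     = refl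
cons-+ true  false 𝟘     𝟘     = refl
cons-+ true  false 𝟘     ⟨ _ ⟩ = refl
cons-+ true  true  𝟘     𝟘     = refl
cons-+ true  true  𝟘     ⟨ _ ⟩ = refl
cons-+ false false ⟨ _ ⟩ 𝟘     = refl
cons-+ false true  ⟨ _ ⟩ 𝟘     = refl
cons-+ true  false ⟨ _ ⟩ 𝟘     = refl
cons-+ true  true  ⟨ _ ⟩ 𝟘     = refl
cons-+ false false ⟨ _ ⟩ ⟨ _ ⟩ = refl
cons-+ false true  ⟨ _ ⟩ ⟨ _ ⟩ = refl
cons-+ true  false ⟨ _ ⟩ ⟨ _ ⟩ = refl
cons-+ true  true  ⟨ _ ⟩ ⟨ _ ⟩ = refl

+-comm : ∀ p q → p + q ≡ q + p
+-comm = cons-induction _ (λ q → sym (+-identityʳ q)) step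
  where
  step : ∀ a p → (∀ q → p + q ≡ q + p) → ∀ q → cons a p + q ≡ q + cons a p
  step a p ih q = begin
    cons a p + q                    ≡⟨ cong (cons a p +_) (sym (cons-head-tail q)) ⟩
    cons a p + cons (head q) (tail q) ≡⟨ cons-+ a (head q) p (tail q) ⟩
    cons (a xor head q) (p + tail q) ≡⟨ cong₂ cons (xor-comm a (head q)) (ih (tail q)) ⟩
    cons (head q xor a) (tail q + p) ≡⟨ cons-+ (head q) a (tail q) p ⟨
    cons (head q) (tail q) + cons a p ≡⟨ cong (_+ cons a p) (cons-head-tail q) ⟩
    q + cons a p                    ∎

+-assoc : ∀ p q r → (p + q) + r ≡ p + (q + r)
+-assoc = cons-induction _ (λ _ _ → refl) step
  where
  step : ∀ a p → (∀ q r → (p + q) + r ≡ p + (q + r)) →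
         ∀ q r → (cons a p + q) + r ≡ cons a p + (q + r)
  step a p ih q r = begin
    (cons a p + q) + r
      ≡⟨ cong₂ (λ u v → (cons a p + u) + v) (sym (cons-head-tail q)) (sym (cons-head-tail r)) ⟩
    (cons a p + cons b q′) + cons c r′
      ≡⟨ cong (_+ cons c r′) (cons-+ a b p q′) ⟩
    cons (a xor b) (p + q′) + cons c r′
      ≡⟨ cons-+ (a xor b) c (p + q′) r′ ⟩
    cons ((a xor b) xor c) ((p + q′) + r′)
      ≡⟨ cong₂ cons (xor-assoc a b c) (ih q′ r′) ⟩
    cons (a xor (b xor c)) (p + (q′ + r′))
      ≡⟨ cons-+ a (b xor c) p (q′ + r′) ⟨
    cons a p + cons (b xor c) (q′ + r′)
      ≡⟨ cong (cons a p +_) (cons-+ b c q′ r′) ⟨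
    cons a p + (cons b q′ + cons c r′)
      ≡⟨ cong₂ (λ u v → cons a p + (u + v)) (cons-head-tail q) (cons-head-tail r) ⟩
    cons a p + (q + r) ∎
    where
    b = head q; q′ = tail q; c = head r; r′ = tail r

x+x≡𝟘 : ∀ p → p + p ≡ 𝟘
x+x≡𝟘 = cons-induction _ refl λ a p ih → trans (cons-+ a a p p) (cong₂ cons (xor-same a) ih)

+-isCommutativeMonoid : IsCommutativeMonoid _≡_ _+_ 𝟘
+-isCommutativeMonoid = isCommutativeMonoidˡ record
  { isSemigroup = record { isMagma = record { isEquivalence = isEquivalence ; ∙-cong = cong₂ _+_ }
                         ; assoc = +-assoc }
  ; identityˡ = λ _ → refl
  ; comm = +-comm
  }

+-commutativeMonoid : CommutativeMonoid 0ℓ 0ℓ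
+-commutativeMonoid = record { isCommutativeMonoid = +-isCommutativeMonoid }

open CommutativeSemigroupProperties (CommutativeMonoid.commutativeSemigroup +-commutativeMonoid)
  using () renaming (interchange to +-interchange; x∙yz≈y∙xz to x+yz≡y+xz)

+-cancelˡ : ∀ a {b c} → a + b ≡ a + c → b ≡ c
+-cancelˡ a {b} {c} a+b≡a+c = begin
  b             ≡⟨ cong (_+ b) (x+x≡𝟘 a) ⟨
  (a + a) + b   ≡⟨ +-assoc a a b ⟩
  a + (a + b)   ≡⟨ cong (a +_) a+b≡a+c ⟩
  a + (a + c)   ≡⟨ +-assoc a a c ⟨
  (a + a) + c   ≡⟨ cong (_+ c) (x+x≡𝟘 a) ⟩
  c             ∎

+-cancelʳ : ∀ {a b} c → a + c ≡ b + c → a ≡ b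
+-cancelʳ {a} {b} c a+c≡b+c = +-cancelˡ c (trans (+-comm c a) (trans a+c≡b+c (+-comm b c)))

x+y≡𝟘⇒x≡y : ∀ {a b} → a + b ≡ 𝟘 → a ≡ b
x+y≡𝟘⇒x≡y {a} a+b≡𝟘 = +-cancelˡ a (trans (x+x≡𝟘 a) (sym a+b≡𝟘))

x≡y+z⇒z≡x+y : ∀ {x y z} → x ≡ y + z → z ≡ x + y
x≡y+z⇒z≡x+y {x} {y} {z} x≡y+z = +-cancelˡ y (begin
  y + z       ≡⟨ x≡y+z ⟨
  x           ≡⟨ +-identityʳ x ⟨
  x + 𝟘       ≡⟨ cong (x +_) (x+x≡𝟘 y) ⟨
  x + (y + y) ≡⟨ +-assoc x y y ⟨
  (x + y) + y ≡⟨ +-comm (x + y) y ⟩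
  y + (x + y) ∎)

infixr 7 _·_
_·_ : Bool → Poly → Poly
b · q = if b then q else 𝟘

cons-* : ∀ b p q → cons b p * q ≡ b · q + X * (p * q)
cons-* false 𝟘     q = refl
cons-* true  𝟘     q = sym (+-identityʳ q)
cons-* false ⟨ _ ⟩ q = refl
cons-* true  ⟨ _ ⟩ q = refl

·-distribʳ-xor : ∀ a b r → (a xor b) · r ≡ a · r + b · r
·-distribʳ-xor false b     r = refl
·-distribʳ-xor true  false r = sym (+-identityʳ r)
·-distribʳ-xor true  true  r = sym (x+x≡𝟘 r)

·-distribˡ-+ : ∀ c p q → c · (p + q) ≡ c · p + c · q
·-distribˡ-+ false p q = refl
·-distribˡ-+ true  p q = refl

X*-distrib-+ : ∀ p q → X * p + X * q ≡ X * (p + q)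
X*-distrib-+ = cons-+ false false

*-zeroʳ : ∀ p → p * 𝟘 ≡ 𝟘
*-zeroʳ = cons-induction _ refl λ b p ih → begin
  cons b p * 𝟘        ≡⟨ cons-* b p 𝟘 ⟩
  b · 𝟘 + X * (p * 𝟘) ≡⟨ cong (λ u → b · 𝟘 + X * u) ih ⟩
  b · 𝟘 + 𝟘           ≡⟨ +-identityʳ (b · 𝟘) ⟩
  b · 𝟘               ≡⟨ ·-zero b ⟩
  𝟘                   ∎
  where
  ·-zero : ∀ b → b · 𝟘 ≡ 𝟘
  ·-zero false = refl
  ·-zero true  = refl

*-distribʳ-+ : ∀ p q r → (p + q) * r ≡ p * r + q * r
*-distribʳ-+ = cons-induction _ (λ _ _ → refl) step
  where
  step : ∀ a p → (∀ q r → (p + q) * r ≡ p * r + q * r) →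
         ∀ q r → (cons a p + q) * r ≡ cons a p * r + q * r
  step a p ih q r = begin
    (cons a p + q) * r
      ≡⟨ cong (λ u → (cons a p + u) * r) (sym (cons-head-tail q)) ⟩
    (cons a p + cons b q′) * r
      ≡⟨ cong (_* r) (cons-+ a b p q′) ⟩
    cons (a xor b) (p + q′) * r
      ≡⟨ cons-* (a xor b) (p + q′) r ⟩
    (a xor b) · r + X * ((p + q′) * r)
      ≡⟨ cong₂ (λ u v → u + X * v) (·-distribʳ-xor a b r) (ih q′ r) ⟩
    (a · r + b · r) + X * (p * r + q′ * r)
      ≡⟨ cong ((a · r + b · r) +_) (X*-distrib-+ (p * r) (q′ * r)) ⟨
    (a · r + b · r) + (X * (p * r) + X * (q′ * r))
      ≡⟨ +-interchange (a · r) (b · r) (X * (p * r)) (X * (q′ * r)) ⟩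
    (a · r + X * (p * r)) + (b · r + X * (q′ * r))
      ≡⟨ cong₂ _+_ (cons-* a p r) (cons-* b q′ r) ⟨
    cons a p * r + cons b q′ * r
      ≡⟨ cong (λ u → cons a p * r + u * r) (cons-head-tail q) ⟩
    cons a p * r + q * r ∎
    where
    b = head q; q′ = tail q

*-distribˡ-+ : ∀ r p q → r * (p + q) ≡ r * p + r * q
*-distribˡ-+ = cons-induction _ (λ _ _ → refl) λ c r ih p q → begin
  cons c r * (p + q)                       ≡⟨ cons-* c r (p + q) ⟩
  c · (p + q) + X * (r * (p + q))          ≡⟨ cong₂ (λ u v → u + X * v) (·-distribˡ-+ c p q) (ih p q) ⟩
  (c · p + c · q) + X * (r * p + r * q)    ≡⟨ cong ((c · p + c · q) +_) (X*-distrib-+ (r * p) (r * q)) ⟨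
  (c · p + c · q) + (X * (r * p) + X * (r * q))
                                           ≡⟨ +-interchange (c · p) (c · q) (X * (r * p)) (X * (r * q)) ⟩
  (c · p + X * (r * p)) + (c · q + X * (r * q))
                                           ≡⟨ cong₂ _+_ (cons-* c r p) (cons-* c r q) ⟨
  cons c r * p + cons c r * q              ∎

cons≡·𝟙+X* : ∀ a p → cons a p ≡ a · 𝟙 + X * p
cons≡·𝟙+X* false p = refl
cons≡·𝟙+X* true  p = sym (cons-+ true false 𝟘 p)

*-identityʳ : ∀ p → p * 𝟙 ≡ p
*-identityʳ = cons-induction _ refl λ b p ih → begin
  cons b p * 𝟙        ≡⟨ cons-* b p 𝟙 ⟩
  b · 𝟙 + X * (p * 𝟙) ≡⟨ cong (λ u → b · 𝟙 + X * u) ih ⟩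
  b · 𝟙 + X * p       ≡⟨ cons≡·𝟙+X* b p ⟨
  cons b p            ∎

*-X* : ∀ q p → q * (X * p) ≡ X * (q * p)
*-X* = cons-induction _ (λ _ → refl) λ b q ih p → begin
  cons b q * (X * p)              ≡⟨ cons-* b q (X * p) ⟩
  b · (X * p) + X * (q * (X * p)) ≡⟨ cong₂ (λ u v → u + X * v) (·-X* b p) (ih p) ⟩
  X * (b · p) + X * (X * (q * p)) ≡⟨ X*-distrib-+ (b · p) (X * (q * p)) ⟩
  X * (b · p + X * (q * p))       ≡⟨ cong (X *_) (cons-* b q p) ⟨
  X * (cons b q * p)              ∎
  where
  ·-X* : ∀ b p → b · (X * p) ≡ X * (b · p)
  ·-X* false _ = refl
  ·-X* true  _ = refl

*-·𝟙 : ∀ a q → q * (a · 𝟙) ≡ a · q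
*-·𝟙 false q = *-zeroʳ q
*-·𝟙 true  q = *-identityʳ q

*-comm : ∀ p q → p * q ≡ q * p
*-comm = cons-induction _ (λ q → sym (*-zeroʳ q)) λ a p ih q → begin
  cons a p * q            ≡⟨ cons-* a p q ⟩
  a · q + X * (p * q)     ≡⟨ cong₂ (λ u v → u + X * v) (sym (*-·𝟙 a q)) (ih q) ⟩
  q * (a · 𝟙) + X * (q * p) ≡⟨ cong (q * (a · 𝟙) +_) (*-X* q p) ⟨
  q * (a · 𝟙) + q * (X * p) ≡⟨ *-distribˡ-+ q (a · 𝟙) (X * p) ⟨
  q * (a · 𝟙 + X * p)     ≡⟨ cong (q *_) (cons≡·𝟙+X* a p) ⟨
  q * cons a p            ∎

*-assoc : ∀ p q r → (p * q) * r ≡ p * (q * r)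
*-assoc = cons-induction _ (λ _ _ → refl) λ a p ih q r → begin
  (cons a p * q) * r                  ≡⟨ cong (_* r) (cons-* a p q) ⟩
  (a · q + X * (p * q)) * r           ≡⟨ *-distribʳ-+ (a · q) (X * (p * q)) r ⟩
  (a · q) * r + (X * (p * q)) * r     ≡⟨ cong₂ _+_ (·-* a q r) (cons-* false (p * q) r) ⟩
  a · (q * r) + X * ((p * q) * r)     ≡⟨ cong (λ u → a · (q * r) + X * u) (ih q r) ⟩
  a · (q * r) + X * (p * (q * r))     ≡⟨ cons-* a p (q * r) ⟨
  cons a p * (q * r)                  ∎
  where
  ·-* : ∀ a q r → (a · q) * r ≡ a · (q * r)
  ·-* false _ _ = refl
  ·-* true  _ _ = refl

*-isCommutativeMonoid : IsCommutativeMonoid _≡_ _*_ 𝟙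
*-isCommutativeMonoid = isCommutativeMonoidˡ record
  { isSemigroup = record { isMagma = record { isEquivalence = isEquivalence ; ∙-cong = cong₂ _*_ }
                         ; assoc = *-assoc }
  ; identityˡ = λ _ → refl
  ; comm = *-comm
  }

*-commutativeMonoid : CommutativeMonoid 0ℓ 0ℓ
*-commutativeMonoid = record { isCommutativeMonoid = *-isCommutativeMonoid }

open CommutativeSemigroupProperties (CommutativeMonoid.commutativeSemigroup *-commutativeMonoid)
  using () renaming ( interchange to *-interchange; x∙yz≈y∙xz to x*yz≡y*xz; x∙yz≈z∙xy to x*yz≡z*xy
                    ; x∙yz≈xz∙y to x*yz≡xz*y; xy∙z≈x∙zy to xy*z≡x*zy)

-- Unlike deg, size separates 𝟘 from the nonzero constants, so a remainder is anything of smaller size.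
size : Poly → ℕ
size 𝟘     = 0
size ⟨ p ⟩ = suc (deg⁺ p)

size-rec : (P : Poly → Set) → (∀ A → (∀ {B} → size B < size A → P B) → P A) → ∀ A → P A
size-rec = WF.All.wfRec (On.wellFounded size <-wellFounded) 0ℓ

cons-⟨⟩ : ∀ b p → cons b ⟨ p ⟩ ≡ ⟨ b ∷⁺ p ⟩
cons-⟨⟩ false _ = refl
cons-⟨⟩ true  _ = refl

size-cons : ∀ b p → size (cons b p) ≤ suc (size p)
size-cons false 𝟘     = z≤n
size-cons true  𝟘     = ≤-refl
size-cons false ⟨ _ ⟩ = ≤-refl
size-cons true  ⟨ _ ⟩ = ≤-refl

size-· : ∀ b p → size (b · p) ≤ size p
size-· false _ = z≤n
size-· true  _ = ≤-refl

+-lower : ∀ u v → size u ≤ deg⁺ v → ∃[ w ] u + ⟨ v ⟩ ≡ ⟨ w ⟩ × deg⁺ w ≡ deg⁺ v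
+-lower 𝟘     v _ = v , refl , refl
+-lower ⟨ u ⟩ v u<v = go u v u<v
  where
  go : ∀ u v → suc (deg⁺ u) ≤ deg⁺ v → ∃[ w ] add⁺ u v ≡ ⟨ w ⟩ × deg⁺ w ≡ deg⁺ v
  go one      (b ∷⁺ v) _ = not b ∷⁺ v , refl , refl
  go (a ∷⁺ u) (b ∷⁺ v) (s≤s u<v) with go u v u<v
  ... | w , add≡w , deg≡ =
    (a xor b) ∷⁺ w , trans (cong (cons (a xor b)) add≡w) (cons-⟨⟩ (a xor b) w) , cong suc deg≡

+-cancel-leading : ∀ u v → size u ≡ size v → u ≢ 𝟘 → size (u + v) < size u
+-cancel-leading 𝟘     _     _      u≢𝟘 = ⊥-elim (u≢𝟘 refl)
+-cancel-leading ⟨ u ⟩ ⟨ v ⟩ size≡ _   = go u v size≡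
  where
  go : ∀ u v → suc (deg⁺ u) ≡ suc (deg⁺ v) → size (add⁺ u v) < suc (deg⁺ u)
  go one      one      _     = s≤s z≤n
  go (a ∷⁺ u) (b ∷⁺ v) deg≡ =
    ≤-<-trans (size-cons (a xor b) (add⁺ u v)) (s≤s (go u v (suc-injective deg≡)))

mul⁺-deg : ∀ p q → ∃[ r ] mul⁺ p ⟨ q ⟩ ≡ ⟨ r ⟩ × deg⁺ r ≡ deg⁺ p +ℕ deg⁺ q
mul⁺-deg one      q = q , refl , refl
mul⁺-deg (b ∷⁺ p) q with mul⁺-deg p q
... | r , pq≡r , deg-r with +-lower (b · ⟨ q ⟩) (false ∷⁺ r) b·q≤r
  where
  b·q≤r : size (b · ⟨ q ⟩) ≤ suc (deg⁺ r)
  b·q≤r = ≤-trans (size-· b ⟨ q ⟩) (s≤s (subst (deg⁺ q ≤_) (sym deg-r) (m≤n+m (deg⁺ q) (deg⁺ p))))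
... | w , sum≡w , deg-w = w , trans (cong (λ z → b · ⟨ q ⟩ + cons false z) pq≡r) sum≡w
                            , trans deg-w (cong suc deg-r)

*-≢𝟘 : ∀ {p q} → p ≢ 𝟘 → q ≢ 𝟘 → p * q ≢ 𝟘
*-≢𝟘 {𝟘}     p≢𝟘 _   = ⊥-elim (p≢𝟘 refl)
*-≢𝟘 {⟨ _ ⟩} {𝟘} _ q≢𝟘 = ⊥-elim (q≢𝟘 refl)
*-≢𝟘 {⟨ p ⟩} {⟨ q ⟩} _ _ pq≡𝟘 with mul⁺-deg p q
... | r , pq≡r , _ with trans (sym pq≡𝟘) pq≡r
... | ()

deg-* : ∀ {p q} → p ≢ 𝟘 → q ≢ 𝟘 → deg (p * q) ≡ deg p +ℕ deg q
deg-* {𝟘}     p≢𝟘 _   = ⊥-elim (p≢𝟘 refl)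
deg-* {⟨ _ ⟩} {𝟘} _ q≢𝟘 = ⊥-elim (q≢𝟘 refl)
deg-* {⟨ p ⟩} {⟨ q ⟩} _ _ with mul⁺-deg p q
... | r , pq≡r , deg-r = trans (cong deg pq≡r) deg-r

*≢𝟘⇒≢𝟘ˡ : ∀ p q → p * q ≢ 𝟘 → p ≢ 𝟘
*≢𝟘⇒≢𝟘ˡ _ _ pq≢𝟘 refl = pq≢𝟘 refl

*≢𝟘⇒≢𝟘ʳ : ∀ p q → p * q ≢ 𝟘 → q ≢ 𝟘
*≢𝟘⇒≢𝟘ʳ p _ pq≢𝟘 refl = pq≢𝟘 (*-zeroʳ p)

≢𝟘-factorˡ : ∀ {A d q} → A ≢ 𝟘 → d * q ≡ A → d ≢ 𝟘
≢𝟘-factorˡ {q = q} A≢𝟘 refl = *≢𝟘⇒≢𝟘ˡ _ q A≢𝟘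

≢𝟘-factorʳ : ∀ {A d q} → A ≢ 𝟘 → d * q ≡ A → q ≢ 𝟘
≢𝟘-factorʳ {d = d} A≢𝟘 refl = *≢𝟘⇒≢𝟘ʳ d _ A≢𝟘

*-cancelˡ : ∀ {a} x y → a ≢ 𝟘 → a * x ≡ a * y → x ≡ y
*-cancelˡ {a} x y a≢𝟘 ax≡ay with x + y ≟ 𝟘
... | yes x+y≡𝟘 = x+y≡𝟘⇒x≡y x+y≡𝟘
... | no  x+y≢𝟘 = ⊥-elim (*-≢𝟘 a≢𝟘 x+y≢𝟘 (begin
  a * (x + y)   ≡⟨ *-distribˡ-+ a x y ⟩
  a * x + a * y ≡⟨ cong (_+ a * y) ax≡ay ⟩
  a * y + a * y ≡⟨ x+x≡𝟘 (a * y) ⟩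
  𝟘             ∎))

cofactor-unique : ∀ {A d q r} → A ≢ 𝟘 → d * q ≡ A → d * r ≡ A → q ≡ r
cofactor-unique {d = d} {q} {r} A≢𝟘 dq≡A dr≡A =
  *-cancelˡ {d} q r (≢𝟘-factorˡ {q = q} A≢𝟘 dq≡A) (trans dq≡A (sym dr≡A))

deg≡0⇒≡𝟙 : ∀ {p} → p ≢ 𝟘 → deg p ≡ 0 → p ≡ 𝟙
deg≡0⇒≡𝟙 {𝟘}           p≢𝟘 _ = ⊥-elim (p≢𝟘 refl)
deg≡0⇒≡𝟙 {⟨ one ⟩}     _   _ = refl
deg≡0⇒≡𝟙 {⟨ _ ∷⁺ _ ⟩} _   ()

*≡𝟙⇒≡𝟙 : ∀ {a b} → a * b ≡ 𝟙 → a ≡ 𝟙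
*≡𝟙⇒≡𝟙 {a} {b} ab≡𝟙 = deg≡0⇒≡𝟙 a≢𝟘 (m+n≡0⇒m≡0 (deg a) (trans (sym (deg-* a≢𝟘 b≢𝟘)) (cong deg ab≡𝟙)))
  where
  ab≢𝟘 : a * b ≢ 𝟘
  ab≢𝟘 ab≡𝟘 with trans (sym ab≡𝟙) ab≡𝟘
  ... | ()
  a≢𝟘 = *≢𝟘⇒≢𝟘ˡ a b ab≢𝟘
  b≢𝟘 = *≢𝟘⇒≢𝟘ʳ a b ab≢𝟘

size≡suc-deg : ∀ {p} → p ≢ 𝟘 → size p ≡ suc (deg p)
size≡suc-deg {𝟘}     p≢𝟘 = ⊥-elim (p≢𝟘 refl)
size≡suc-deg {⟨ _ ⟩} _   = refl

size<size-*ˡ : ∀ {p q} → p ≢ 𝟘 → q ≢ 𝟘 → q ≢ 𝟙 → size p < size (p * q)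
size<size-*ˡ {p} {q} p≢𝟘 q≢𝟘 q≢𝟙 =
  subst₂ _<_ (sym (size≡suc-deg p≢𝟘))
             (trans (cong suc (sym (deg-* p≢𝟘 q≢𝟘))) (sym (size≡suc-deg (*-≢𝟘 p≢𝟘 q≢𝟘))))
             (s≤s (m<m+n (deg p) (n≢0⇒n>0 (q≢𝟙 ∘ deg≡0⇒≡𝟙 q≢𝟘))))

size<size-*ʳ : ∀ {p q} → p ≢ 𝟘 → q ≢ 𝟘 → p ≢ 𝟙 → size q < size (p * q)
size<size-*ʳ {p} {q} p≢𝟘 q≢𝟘 p≢𝟙 = subst (λ r → size q < size r) (*-comm q p) (size<size-*ˡ q≢𝟘 p≢𝟘 p≢𝟙)

deg≤deg-*ˡ : ∀ p q → p * q ≢ 𝟘 → deg p ≤ deg (p * q)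
deg≤deg-*ˡ p q pq≢𝟘 =
  subst (deg p ≤_) (sym (deg-* (*≢𝟘⇒≢𝟘ˡ p q pq≢𝟘) (*≢𝟘⇒≢𝟘ʳ p q pq≢𝟘))) (m≤m+n (deg p) (deg q))

deg≤deg-*ʳ : ∀ p q → p * q ≢ 𝟘 → deg q ≤ deg (p * q)
deg≤deg-*ʳ p q pq≢𝟘 =
  subst (λ r → deg q ≤ deg r) (*-comm q p) (deg≤deg-*ˡ q p (subst (_≢ 𝟘) (*-comm p q) pq≢𝟘))

-- Long division from the constant term up: after dividing the tail, cons a R can reach the size of B,
-- and one subtraction of B then cancels its leading term.
divMod : ∀ {B} → B ≢ 𝟘 → ∀ A → ∃[ Q ] ∃[ R ] A ≡ Q * B + R × size R < size B
divMod {B} B≢𝟘 = cons-induction _ (𝟘 , 𝟘 , refl , 0<size) step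
  where
  0<size : 0 < size B
  0<size = subst (0 <_) (sym (size≡suc-deg B≢𝟘)) (s≤s z≤n)
  step : ∀ a A → ∃[ Q ] ∃[ R ] A ≡ Q * B + R × size R < size B →
         ∃[ Q ] ∃[ R ] cons a A ≡ Q * B + R × size R < size B
  step a A (Q , R , A≡ , R<B) = reduce (m≤n⇒m<n∨m≡n (≤-trans (size-cons a R) R<B))
    where
    aA≡ : cons a A ≡ X * Q * B + cons a R
    aA≡ = begin
      cons a A               ≡⟨ cong (cons a) A≡ ⟩
      cons a (Q * B + R)     ≡⟨ cons-+ false a (Q * B) R ⟨
      X * (Q * B) + cons a R ≡⟨ cong (_+ cons a R) (*-assoc X Q B) ⟨
      X * Q * B + cons a R   ∎
    subtract-B : (X * Q + 𝟙) * B + (cons a R + B) ≡ X * Q * B + cons a R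
    subtract-B = begin
      (X * Q + 𝟙) * B + (cons a R + B) ≡⟨ cong (_+ (cons a R + B)) (*-distribʳ-+ (X * Q) 𝟙 B) ⟩
      (X * Q * B + B) + (cons a R + B) ≡⟨ +-interchange (X * Q * B) B (cons a R) B ⟩
      (X * Q * B + cons a R) + (B + B) ≡⟨ cong ((X * Q * B + cons a R) +_) (x+x≡𝟘 B) ⟩
      (X * Q * B + cons a R) + 𝟘       ≡⟨ +-identityʳ _ ⟩
      X * Q * B + cons a R             ∎
    reduce : size (cons a R) < size B ⊎ size (cons a R) ≡ size B →
             ∃[ Q ] ∃[ R ] cons a A ≡ Q * B + R × size R < size B
    reduce (inj₁ aR<B) = X * Q , cons a R , aA≡ , aR<B
    reduce (inj₂ aR≡B) = X * Q + 𝟙 , cons a R + B , trans aA≡ (sym subtract-B)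
                       , subst (size (cons a R + B) <_) aR≡B (+-cancel-leading (cons a R) B aR≡B aR≢𝟘)
      where
      aR≢𝟘 : cons a R ≢ 𝟘
      aR≢𝟘 aR≡𝟘 = <-irrefl refl (subst (0 <_) (trans (sym aR≡B) (cong size aR≡𝟘)) 0<size)

-- Divisibility, Bézout's identity and coprimality

∣-refl : ∀ {A} → A ∣ A
∣-refl {A} = 𝟙 , sym (*-identityʳ A)

∣-trans : ∀ {a b c} → a ∣ b → b ∣ c → a ∣ c
∣-trans {a} (k , refl) (m , refl) = k * m , *-assoc a k m

∣𝟘 : ∀ {A} → A ∣ 𝟘
∣𝟘 {A} = 𝟘 , sym (*-zeroʳ A)

m∣m*n : ∀ a c → a ∣ a * c
m∣m*n _ c = c , refl

∣m⇒∣m*n : ∀ {d a} c → d ∣ a → d ∣ a * c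
∣m⇒∣m*n {d} c (k , refl) = k * c , *-assoc d k c

∣n⇒∣m*n : ∀ {d a} c → d ∣ a → d ∣ c * a
∣n⇒∣m*n {d} {a} c d∣a = subst (d ∣_) (*-comm a c) (∣m⇒∣m*n {d} {a} c d∣a)

∣m∣n⇒∣m+n : ∀ {d a b} → d ∣ a → d ∣ b → d ∣ a + b
∣m∣n⇒∣m+n {d} (k , refl) (m , refl) = k + m , sym (*-distribˡ-+ d k m)

∣𝟙⇒≡𝟙 : ∀ {d} → d ∣ 𝟙 → d ≡ 𝟙
∣𝟙⇒≡𝟙 (k , 𝟙≡dk) = *≡𝟙⇒≡𝟙 (sym 𝟙≡dk)

∣-antisym : ∀ {a b} → b ≢ 𝟘 → a ∣ b → b ∣ a → a ≡ b
∣-antisym {a} {b} b≢𝟘 (k , b≡ak) (m , a≡bm) = begin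
  a     ≡⟨ a≡bm ⟩
  b * m ≡⟨ cong (b *_) (*≡𝟙⇒≡𝟙 (sym (*-cancelˡ 𝟙 (m * k) b≢𝟘 b*𝟙≡b*mk))) ⟩
  b * 𝟙 ≡⟨ *-identityʳ b ⟩
  b     ∎
  where
  b*𝟙≡b*mk : b * 𝟙 ≡ b * (m * k)
  b*𝟙≡b*mk = trans (*-identityʳ b) (trans b≡ak (trans (cong (_* k) a≡bm) (*-assoc b m k)))

record Bézout (A B : Poly) : Set where
  constructor mkBézout
  field
    gcd   : Poly
    gcd∣A : gcd ∣ A
    gcd∣B : gcd ∣ B
    U V   : Poly
    gcd≡  : gcd ≡ U * A + V * B

bézout : ∀ A B → Bézout A B
bézout A B = size-rec (λ B → ∀ A → Bézout A B) step B A
  where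
  step : ∀ B → (∀ {R} → size R < size B → ∀ A → Bézout A R) → ∀ A → Bézout A B
  step B rec A with B ≟ 𝟘
  ... | yes refl = mkBézout A (∣-refl {A}) (∣𝟘 {A}) 𝟙 𝟘 (sym (+-identityʳ A))
  ... | no B≢𝟘 with divMod B≢𝟘 A
  ... | Q , R , A≡QB+R , R<B with rec R<B B
  ... | mkBézout G G∣B G∣R U V G≡ =
    mkBézout G (subst (G ∣_) (sym A≡QB+R) (∣m∣n⇒∣m+n {G} (∣n⇒∣m*n {G} Q G∣B) G∣R)) G∣B
             V (U + V * Q) (begin
      G                               ≡⟨ G≡ ⟩
      U * B + V * R                   ≡⟨ cong (λ z → U * B + V * z) (x≡y+z⇒z≡x+y A≡QB+R) ⟩
      U * B + V * (A + Q * B)         ≡⟨ cong (U * B +_) (*-distribˡ-+ V A (Q * B)) ⟩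
      U * B + (V * A + V * (Q * B))   ≡⟨ +-assoc (U * B) (V * A) _ ⟨
      (U * B + V * A) + V * (Q * B)   ≡⟨ cong₂ _+_ (+-comm (U * B) (V * A)) (sym (*-assoc V Q B)) ⟩
      (V * A + U * B) + (V * Q) * B   ≡⟨ +-assoc (V * A) (U * B) _ ⟩
      V * A + (U * B + (V * Q) * B)   ≡⟨ cong (V * A +_) (*-distribʳ-+ U (V * Q) B) ⟨
      V * A + (U + V * Q) * B         ∎)

coprime-∣ : ∀ {a b M N} → a ∣ M → b ∣ N → Coprime M N → Coprime a b
coprime-∣ {a} {b} a∣M b∣N M⊥N D D∣a D∣b = M⊥N D (∣-trans {D} {a} D∣a a∣M) (∣-trans {D} {b} D∣b b∣N)

Bézout-coprime : ∀ {A B} U V → U * A + V * B ≡ 𝟙 → Coprime A B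
Bézout-coprime {A} {B} U V UA+VB≡𝟙 D D∣A D∣B =
  ∣𝟙⇒≡𝟙 (subst (D ∣_) UA+VB≡𝟙 (∣m∣n⇒∣m+n {D} (∣n⇒∣m*n {D} U D∣A) (∣n⇒∣m*n {D} V D∣B)))

coprime-Bézout : ∀ {A B} → Coprime A B → ∃[ U ] ∃[ V ] U * A + V * B ≡ 𝟙
coprime-Bézout {A} {B} A⊥B = U , V , trans (sym gcd≡) (A⊥B gcd gcd∣A gcd∣B)
  where open Bézout (bézout A B)

coprime-divisor : ∀ {a b c} → Coprime a c → a ∣ b * c → a ∣ b
coprime-divisor {a} {b} {c} a⊥c (k , bc≡ak) with coprime-Bézout a⊥c
... | U , V , Ua+Vc≡𝟙 = b * U + V * k , (begin
  b                         ≡⟨ *-identityʳ b ⟨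
  b * 𝟙                     ≡⟨ cong (b *_) Ua+Vc≡𝟙 ⟨
  b * (U * a + V * c)       ≡⟨ *-distribˡ-+ b (U * a) (V * c) ⟩
  b * (U * a) + b * (V * c) ≡⟨ cong₂ _+_ (x*yz≡z*xy b U a) (x*yz≡y*xz b V c) ⟩
  a * (b * U) + V * (b * c) ≡⟨ cong (λ z → a * (b * U) + V * z) bc≡ak ⟩
  a * (b * U) + V * (a * k) ≡⟨ cong (a * (b * U) +_) (x*yz≡y*xz V a k) ⟩
  a * (b * U) + a * (V * k) ≡⟨ *-distribˡ-+ a (b * U) (V * k) ⟨
  a * (b * U + V * k)       ∎)

irreducible-∣⊎coprime : ∀ {P} → Irreducible P → ∀ D → P ∣ D ⊎ Coprime P D
irreducible-∣⊎coprime {P} (_ , _ , factors) D with bézout P D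
... | mkBézout G (k , P≡Gk) G∣D U V G≡ with factors G k P≡Gk
... | inj₁ G≡𝟙 = inj₂ (Bézout-coprime U V (trans (sym G≡) G≡𝟙))
... | inj₂ k≡𝟙 = inj₁ (subst (_∣ D) (sym (trans P≡Gk (trans (cong (G *_) k≡𝟙) (*-identityʳ G)))) G∣D)

module _ {A : Set} where

  ∑ : (A → Poly) → List A → Poly
  ∑ f xs = sumP (map f xs)

  ∑-++ : ∀ f xs ys → ∑ f (xs ++ ys) ≡ ∑ f xs + ∑ f ys
  ∑-++ f []       ys = refl
  ∑-++ f (x ∷ xs) ys = trans (cong (f x +_) (∑-++ f xs ys)) (sym (+-assoc (f x) _ _))

  ∑-cong : ∀ {f g} xs → (∀ {x} → x ∈ xs → f x ≡ g x) → ∑ f xs ≡ ∑ g xs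
  ∑-cong xs f≡g = cong sumP (map-cong-local (All.tabulate f≡g))

  ∑-+ : ∀ f g xs → ∑ (λ x → f x + g x) xs ≡ ∑ f xs + ∑ g xs
  ∑-+ f g []       = refl
  ∑-+ f g (x ∷ xs) = trans (cong (f x + g x +_) (∑-+ f g xs)) (+-interchange (f x) (g x) _ _)

  ∑-*ˡ : ∀ c f xs → ∑ (λ x → c * f x) xs ≡ c * ∑ f xs
  ∑-*ˡ c f []       = sym (*-zeroʳ c)
  ∑-*ˡ c f (x ∷ xs) = trans (cong (c * f x +_) (∑-*ˡ c f xs)) (sym (*-distribˡ-+ c (f x) _))

  ∑-𝟘 : ∀ xs → ∑ (λ _ → 𝟘) xs ≡ 𝟘
  ∑-𝟘 []       = refl
  ∑-𝟘 (_ ∷ xs) = ∑-𝟘 xs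

  ∑-filter : ∀ f {P : A → Set} (P? : Decidable P) xs →
             ∑ f xs ≡ ∑ f (filter P? xs) + ∑ f (filter (∁? P?) xs)
  ∑-filter f P? []       = refl
  ∑-filter f P? (x ∷ xs) with P? x
  ... | yes _ = trans (cong (f x +_) (∑-filter f P? xs)) (sym (+-assoc (f x) _ _))
  ... | no  _ = trans (cong (f x +_) (∑-filter f P? xs))
                      (x+yz≡y+xz (f x) (∑ f (filter P? xs)) (∑ f (filter (∁? P?) xs)))

  ∑-↭ : ∀ f {xs ys} → xs ↭ ys → ∑ f xs ≡ ∑ f ys
  ∑-↭ f xs↭ys = foldr-commMonoid +-isCommutativeMonoid (↭⇒↭ₛ (↭.map⁺ f xs↭ys))

  ∑-set : ∀ f {xs ys} → Unique xs → Unique ys → xs ∼[ set ] ys → ∑ f xs ≡ ∑ f ys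
  ∑-set f xs! ys! xs≈ys = ∑-↭ f (∼bag⇒↭ (unique∧set⇒bag xs! ys! xs≈ys))

∑-map : ∀ {A B : Set} (f : B → Poly) (g : A → B) xs → ∑ f (map g xs) ≡ ∑ (f ∘ g) xs
∑-map f g xs = cong sumP (sym (map-∘ xs))

∑-cartesianProduct : ∀ {A B : Set} (f : A → Poly) (g : B → Poly) xs ys →
  ∑ (λ xy → f (proj₁ xy) * g (proj₂ xy)) (cartesianProduct xs ys) ≡ ∑ f xs * ∑ g ys
∑-cartesianProduct f g []       ys = refl
∑-cartesianProduct f g (x ∷ xs) ys = begin
  ∑ h (map (x ,_) ys ++ cartesianProduct xs ys)
    ≡⟨ ∑-++ h (map (x ,_) ys) _ ⟩
  ∑ h (map (x ,_) ys) + ∑ h (cartesianProduct xs ys)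
    ≡⟨ cong₂ _+_ (trans (∑-map h (x ,_) ys) (∑-*ˡ (f x) g ys)) (∑-cartesianProduct f g xs ys) ⟩
  f x * ∑ g ys + ∑ f xs * ∑ g ys
    ≡⟨ *-distribʳ-+ (f x) (∑ f xs) (∑ g ys) ⟨
  (f x + ∑ f xs) * ∑ g ys ∎
  where
  h = λ xy → f (proj₁ xy) * g (proj₂ xy)

Unique-map⁺-local : ∀ {A B : Set} (f : A → B) {xs} →
  (∀ {x y} → x ∈ xs → y ∈ xs → f x ≡ f y → x ≡ y) → Unique xs → Unique (map f xs)
Unique-map⁺-local f {[]}     _   []           = []
Unique-map⁺-local f {x ∷ xs} inj (x∉xs ∷ xs!) =
  All.map⁺ (All.tabulate λ y∈xs fx≡fy → All.lookup x∉xs y∈xs (inj (here refl) (there y∈xs) fx≡fy))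
  ∷ Unique-map⁺-local f (λ x∈ y∈ → inj (there x∈) (there y∈)) xs!

polys⁺≤-complete : ∀ n p → deg⁺ p ≤ n → p ∈ polys⁺≤ n
polys⁺≤-complete zero    one          _         = here refl
polys⁺≤-complete (suc n) one          _         = here refl
polys⁺≤-complete (suc n) (false ∷⁺ p) (s≤s p≤n) =
  there (∈-++⁺ˡ (∈-map⁺ (false ∷⁺_) (polys⁺≤-complete n p p≤n)))
polys⁺≤-complete (suc n) (true ∷⁺ p)  (s≤s p≤n) =
  there (∈-++⁺ʳ (map (false ∷⁺_) (polys⁺≤ n)) (∈-map⁺ (true ∷⁺_) (polys⁺≤-complete n p p≤n)))

polys≤-complete : ∀ n p → deg p ≤ n → p ∈ polys≤ n
polys≤-complete n 𝟘     _   = here refl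
polys≤-complete n ⟨ p ⟩ p≤n = there (∈-map⁺ ⟨_⟩ (polys⁺≤-complete n p p≤n))

polys⁺≤-unique : ∀ n → Unique (polys⁺≤ n)
polys⁺≤-unique zero    = [] ∷ []
polys⁺≤-unique (suc n) =
  All.++⁺ (one≢ false) (one≢ true)
  ∷ Unique.++⁺ (Unique.map⁺ ∷⁺-injective (polys⁺≤-unique n))
                (Unique.map⁺ ∷⁺-injective (polys⁺≤-unique n))
                disjoint
  where
  one≢ : ∀ b → All (one ≢_) (map (b ∷⁺_) (polys⁺≤ n))
  one≢ b = All.map⁺ (All.universal (λ _ ()) (polys⁺≤ n))
  ∷⁺-injective : ∀ {b p q} → b ∷⁺ p ≡ b ∷⁺ q → p ≡ q
  ∷⁺-injective refl = refl
  disjoint : ∀ {v} → ¬ (v ∈ map (false ∷⁺_) (polys⁺≤ n) × v ∈ map (true ∷⁺_) (polys⁺≤ n))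
  disjoint (v∈₀ , v∈₁) with ∈-map⁻ (false ∷⁺_) v∈₀ | ∈-map⁻ (true ∷⁺_) v∈₁
  ... | _ , _ , refl | _ , _ , ()

polys≤-unique : ∀ n → Unique (polys≤ n)
polys≤-unique n =
  All.map⁺ (All.universal (λ _ ()) (polys⁺≤ n)) ∷ Unique.map⁺ ⟨⟩-injective (polys⁺≤-unique n)
  where
  ⟨⟩-injective : ∀ {p q} → ⟨ p ⟩ ≡ ⟨ q ⟩ → p ≡ q
  ⟨⟩-injective refl = refl

record Factorisations (A : Poly) (L : List (Poly × Poly)) : Set where
  field
    unique   : Unique L
    complete : ∀ {dq} → dq ∈ L ⇔ uncurry _*_ dq ≡ A

∑-Factorisations : ∀ {A L L′} (h : Poly × Poly → Poly) →
  Factorisations A L → Factorisations A L′ → ∑ h L ≡ ∑ h L′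
∑-Factorisations h L-fac L′-fac =
  ∑-set h (Factorisations.unique L-fac) (Factorisations.unique L′-fac)
    (⇔.trans (Factorisations.complete L-fac) (⇔.sym (Factorisations.complete L′-fac)))

divPairs-Factorisations : ∀ {A} → A ≢ 𝟘 → Factorisations A (divPairs A)
divPairs-Factorisations {A} A≢𝟘 = record
  { unique   = subst Unique (sym divPairs≡) (Unique.filter⁺ factor?
                 (Unique.cartesianProduct⁺ (polys≤-unique (deg A)) (polys≤-unique (deg A))))
  ; complete = mk⇔ (proj₂ ∘ ∈-filter⁻ factor? {xs = candidates}) complete⁺
  }
  where
  factor? = λ (dq : Poly × Poly) → uncurry _*_ dq ≟ A
  candidates = concatMap (λ D → map (D ,_) (polys≤ (deg A))) (polys≤ (deg A))
  concatMap-cartesianProduct : ∀ {B C : Set} (xs : List B) (ys : List C) →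
    concatMap (λ x → map (x ,_) ys) xs ≡ cartesianProduct xs ys
  concatMap-cartesianProduct []       ys = refl
  concatMap-cartesianProduct (x ∷ xs) ys = cong (map (x ,_) ys ++_) (concatMap-cartesianProduct xs ys)
  divPairs≡ : divPairs A ≡ filter factor? (cartesianProduct (polys≤ (deg A)) (polys≤ (deg A)))
  divPairs≡ = cong (filter factor?) (concatMap-cartesianProduct (polys≤ (deg A)) (polys≤ (deg A)))
  complete⁺ : ∀ {dq} → uncurry _*_ dq ≡ A → dq ∈ divPairs A
  complete⁺ {D , Q} DQ≡A = subst ((D , Q) ∈_) (sym divPairs≡) (∈-filter⁺ factor?
    (∈-cartesianProduct⁺ (polys≤-complete (deg A) D D≤A) (polys≤-complete (deg A) Q Q≤A))
    DQ≡A)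
    where
    DQ≢𝟘 = subst (_≢ 𝟘) (sym DQ≡A) A≢𝟘
    D≤A = subst (λ B → deg D ≤ deg B) DQ≡A (deg≤deg-*ˡ D Q DQ≢𝟘)
    Q≤A = subst (λ B → deg Q ≤ deg B) DQ≡A (deg≤deg-*ʳ D Q DQ≢𝟘)

∈-divPairs⁻ : ∀ {A dq} → A ≢ 𝟘 → dq ∈ divPairs A → uncurry _*_ dq ≡ A
∈-divPairs⁻ A≢𝟘 = Equivalence.to (Factorisations.complete (divPairs-Factorisations A≢𝟘))

∈-divPairs⁺ : ∀ {A D Q} → A ≢ 𝟘 → D * Q ≡ A → (D , Q) ∈ divPairs A
∈-divPairs⁺ {D = D} {Q} A≢𝟘 =
  Equivalence.from (Factorisations.complete (divPairs-Factorisations A≢𝟘) {D , Q})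

-- Multiplicative functions and Dirichlet convolution

-- With G = gcd M D, the cofactor D / G is coprime to M / G and hence divides N.
factorisation-split : ∀ {M N D Q} → M ≢ 𝟘 → N ≢ 𝟘 → D * Q ≡ M * N →
  ∃[ d₁ ] ∃[ q₁ ] ∃[ d₂ ] ∃[ q₂ ] d₁ * q₁ ≡ M × d₂ * q₂ ≡ N × D ≡ d₁ * d₂ × Q ≡ q₁ * q₂
factorisation-split {M} {N} {D} {Q} M≢𝟘 N≢𝟘 DQ≡MN = split (bézout M D)
  where
  split : Bézout M D →
          ∃[ d₁ ] ∃[ q₁ ] ∃[ d₂ ] ∃[ q₂ ] d₁ * q₁ ≡ M × d₂ * q₂ ≡ N × D ≡ d₁ * d₂ × Q ≡ q₁ * q₂
  split (mkBézout G (q₁ , M≡Gq₁) (D′ , D≡GD′) U V G≡) =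
    G , q₁ , D′ , q₂ , sym M≡Gq₁ , sym N≡D′q₂ , D≡GD′ , Q≡q₁q₂
    where
    G≢𝟘 : G ≢ 𝟘
    G≢𝟘 refl = M≢𝟘 M≡Gq₁
    D′≢𝟘 : D′ ≢ 𝟘
    D′≢𝟘 refl = *-≢𝟘 M≢𝟘 N≢𝟘 (trans (sym DQ≡MN) (cong (_* Q) (trans D≡GD′ (*-zeroʳ G))))
    D′⊥q₁ : Coprime D′ q₁
    D′⊥q₁ = Bézout-coprime V U (*-cancelˡ _ 𝟙 G≢𝟘 (begin
      G * (V * D′ + U * q₁)         ≡⟨ *-distribˡ-+ G (V * D′) (U * q₁) ⟩
      G * (V * D′) + G * (U * q₁)   ≡⟨ cong₂ _+_ (x*yz≡y*xz G V D′) (x*yz≡y*xz G U q₁) ⟩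
      V * (G * D′) + U * (G * q₁)   ≡⟨ cong₂ (λ a b → V * a + U * b) D≡GD′ M≡Gq₁ ⟨
      V * D + U * M                 ≡⟨ +-comm (V * D) (U * M) ⟩
      U * M + V * D                 ≡⟨ G≡ ⟨
      G                             ≡⟨ *-identityʳ G ⟨
      G * 𝟙                         ∎))
    N*q₁≡D′*Q : N * q₁ ≡ D′ * Q
    N*q₁≡D′*Q = *-cancelˡ _ _ G≢𝟘 (begin
      G * (N * q₁)  ≡⟨ x*yz≡xz*y G N q₁ ⟩
      (G * q₁) * N  ≡⟨ cong (_* N) M≡Gq₁ ⟨
      M * N         ≡⟨ DQ≡MN ⟨
      D * Q         ≡⟨ cong (_* Q) D≡GD′ ⟩
      (G * D′) * Q  ≡⟨ *-assoc G D′ Q ⟩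
      G * (D′ * Q)  ∎)
    q₂ = proj₁ (coprime-divisor {D′} {N} {q₁} D′⊥q₁ (Q , N*q₁≡D′*Q))
    N≡D′q₂ = proj₂ (coprime-divisor {D′} {N} {q₁} D′⊥q₁ (Q , N*q₁≡D′*Q))
    Q≡q₁q₂ : Q ≡ q₁ * q₂
    Q≡q₁q₂ = *-cancelˡ _ _ D′≢𝟘 (begin
      D′ * Q         ≡⟨ N*q₁≡D′*Q ⟨
      N * q₁         ≡⟨ cong (_* q₁) N≡D′q₂ ⟩
      (D′ * q₂) * q₁ ≡⟨ xy*z≡x*zy D′ q₂ q₁ ⟩
      D′ * (q₁ * q₂) ∎)

coprime-factor-unique : ∀ {M N d₁ d₂ e₁ e₂} → M ≢ 𝟘 → Coprime M N →
  d₁ ∣ M → e₁ ∣ M → d₂ ∣ N → e₂ ∣ N → d₁ * d₂ ≡ e₁ * e₂ → d₁ ≡ e₁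
coprime-factor-unique {M} {N} {d₁} {d₂} {e₁} {e₂} M≢𝟘 M⊥N d₁∣M e₁∣M d₂∣N e₂∣N d₁d₂≡e₁e₂ =
  ∣-antisym e₁≢𝟘
    (coprime-divisor {d₁} {e₁} {e₂} (coprime-∣ d₁∣M e₂∣N M⊥N) (d₂ , sym d₁d₂≡e₁e₂))
    (coprime-divisor {e₁} {d₁} {d₂} (coprime-∣ e₁∣M d₂∣N M⊥N) (e₂ , d₁d₂≡e₁e₂))
  where
  e₁≢𝟘 : e₁ ≢ 𝟘
  e₁≢𝟘 refl = M≢𝟘 (proj₂ e₁∣M)

pair-* : (Poly × Poly) × (Poly × Poly) → Poly × Poly
pair-* ((d₁ , q₁) , (d₂ , q₂)) = d₁ * d₂ , q₁ * q₂

Factorisations-* : ∀ {M N L₁ L₂} → M ≢ 𝟘 → N ≢ 𝟘 → Coprime M N →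
  Factorisations M L₁ → Factorisations N L₂ →
  Factorisations (M * N) (map pair-* (cartesianProduct L₁ L₂))
Factorisations-* {M} {N} {L₁} {L₂} M≢𝟘 N≢𝟘 M⊥N L₁-fac L₂-fac = record
  { unique   = Unique-map⁺-local pair-* injective
                 (Unique.cartesianProduct⁺ (unique L₁-fac) (unique L₂-fac))
  ; complete = mk⇔ sound complete⁺
  }
  where
  open Factorisations
  factors : ∀ {x} → x ∈ cartesianProduct L₁ L₂ → uncurry _*_ (proj₁ x) ≡ M × uncurry _*_ (proj₂ x) ≡ N
  factors {x} x∈ with ∈-cartesianProduct⁻ L₁ L₂ {x} x∈
  ... | x₁∈ , x₂∈ = Equivalence.to (complete L₁-fac) x₁∈ , Equivalence.to (complete L₂-fac) x₂∈
  injective : ∀ {x y} → x ∈ cartesianProduct L₁ L₂ → y ∈ cartesianProduct L₁ L₂ →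
              pair-* x ≡ pair-* y → x ≡ y
  injective {(d₁ , q₁) , (d₂ , q₂)} {(e₁ , r₁) , (e₂ , r₂)} x∈ y∈ eq with factors x∈ | factors y∈
  ... | d₁q₁≡M , d₂q₂≡N | e₁r₁≡M , e₂r₂≡N
    with coprime-factor-unique {d₁ = d₁} {d₂} {e₁} {e₂} M≢𝟘 M⊥N
           (q₁ , sym d₁q₁≡M) (r₁ , sym e₁r₁≡M) (q₂ , sym d₂q₂≡N) (r₂ , sym e₂r₂≡N) (cong proj₁ eq)
  ... | refl with *-cancelˡ {d₁} d₂ e₂ (≢𝟘-factorˡ {q = q₁} M≢𝟘 d₁q₁≡M) (cong proj₁ eq)
  ... | refl = cong₂ _,_ (cong (d₁ ,_) (cofactor-unique {d = d₁} M≢𝟘 d₁q₁≡M e₁r₁≡M))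
                         (cong (d₂ ,_) (cofactor-unique {d = d₂} N≢𝟘 d₂q₂≡N e₂r₂≡N))
  sound : ∀ {dq} → dq ∈ map pair-* (cartesianProduct L₁ L₂) → uncurry _*_ dq ≡ M * N
  sound dq∈ with ∈-map⁻ pair-* dq∈
  ... | ((d₁ , q₁) , (d₂ , q₂)) , x∈ , refl with factors x∈
  ... | d₁q₁≡M , d₂q₂≡N = trans (*-interchange d₁ d₂ q₁ q₂) (cong₂ _*_ d₁q₁≡M d₂q₂≡N)
  complete⁺ : ∀ {dq} → uncurry _*_ dq ≡ M * N → dq ∈ map pair-* (cartesianProduct L₁ L₂)
  complete⁺ {D , Q} DQ≡MN = combine (factorisation-split {D = D} {Q} M≢𝟘 N≢𝟘 DQ≡MN)
    where
    combine : ∃[ d₁ ] ∃[ q₁ ] ∃[ d₂ ] ∃[ q₂ ] d₁ * q₁ ≡ M × d₂ * q₂ ≡ N × D ≡ d₁ * d₂ × Q ≡ q₁ * q₂ →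
              (D , Q) ∈ map pair-* (cartesianProduct L₁ L₂)
    combine (d₁ , q₁ , d₂ , q₂ , d₁q₁≡M , d₂q₂≡N , refl , refl) =
      ∈-map⁺ pair-* (∈-cartesianProduct⁺ (Equivalence.from (complete L₁-fac {d₁ , q₁}) d₁q₁≡M)
                                         (Equivalence.from (complete L₂-fac {d₂ , q₂}) d₂q₂≡N))

Multiplicative : (Poly → Poly) → Set
Multiplicative f = ∀ A B → A ≢ 𝟘 → B ≢ 𝟘 → Coprime A B → f (A * B) ≡ f A * f B

infixl 7 _⊛_
_⊛_ : (Poly → Poly) → (Poly → Poly) → Poly → Poly
(f ⊛ g) A = ∑ (λ dq → f (proj₁ dq) * g (proj₂ dq)) (divPairs A)

⊛-multiplicative : ∀ {f g} → Multiplicative f → Multiplicative g → Multiplicative (f ⊛ g)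
⊛-multiplicative {f} {g} f-mult g-mult M N M≢𝟘 N≢𝟘 M⊥N = begin
  ∑ h (divPairs (M * N))
    ≡⟨ ∑-Factorisations h (divPairs-Factorisations (*-≢𝟘 M≢𝟘 N≢𝟘))
         (Factorisations-* M≢𝟘 N≢𝟘 M⊥N (divPairs-Factorisations M≢𝟘) (divPairs-Factorisations N≢𝟘)) ⟩
  ∑ h (map pair-* pairs)                      ≡⟨ ∑-map h pair-* pairs ⟩
  ∑ (h ∘ pair-*) pairs                        ≡⟨ ∑-cong pairs h-pair-* ⟩
  ∑ (λ x → h (proj₁ x) * h (proj₂ x)) pairs   ≡⟨ ∑-cartesianProduct h h (divPairs M) (divPairs N) ⟩
  (f ⊛ g) M * (f ⊛ g) N                       ∎
  where
  h : Poly × Poly → Poly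
  h dq = f (proj₁ dq) * g (proj₂ dq)
  pairs = cartesianProduct (divPairs M) (divPairs N)
  h-pair-* : ∀ {x} → x ∈ pairs → h (pair-* x) ≡ h (proj₁ x) * h (proj₂ x)
  h-pair-* {(d₁ , q₁) , (d₂ , q₂)} x∈ with ∈-cartesianProduct⁻ (divPairs M) (divPairs N) x∈
  ... | x₁∈ , x₂∈ = begin
    f (d₁ * d₂) * g (q₁ * q₂)
      ≡⟨ cong₂ _*_ (f-mult d₁ d₂ d₁≢𝟘 d₂≢𝟘 d₁⊥d₂) (g-mult q₁ q₂ q₁≢𝟘 q₂≢𝟘 q₁⊥q₂) ⟩
    (f d₁ * f d₂) * (g q₁ * g q₂) ≡⟨ *-interchange (f d₁) (f d₂) (g q₁) (g q₂) ⟩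
    (f d₁ * g q₁) * (f d₂ * g q₂) ∎
    where
    d₁q₁≡M = ∈-divPairs⁻ M≢𝟘 x₁∈
    d₂q₂≡N = ∈-divPairs⁻ N≢𝟘 x₂∈
    d₁≢𝟘 = ≢𝟘-factorˡ {q = q₁} M≢𝟘 d₁q₁≡M
    q₁≢𝟘 = ≢𝟘-factorʳ {d = d₁} M≢𝟘 d₁q₁≡M
    d₂≢𝟘 = ≢𝟘-factorˡ {q = q₂} N≢𝟘 d₂q₂≡N
    q₂≢𝟘 = ≢𝟘-factorʳ {d = d₂} N≢𝟘 d₂q₂≡N
    d₁⊥d₂ = coprime-∣ (q₁ , sym d₁q₁≡M) (q₂ , sym d₂q₂≡N) M⊥N
    q₁⊥q₂ = coprime-∣ (d₁ , trans (sym d₁q₁≡M) (*-comm d₁ q₁))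
                      (d₂ , trans (sym d₂q₂≡N) (*-comm d₂ q₂)) M⊥N

σ≡id⊛𝟙 : ∀ A → σ A ≡ (id ⊛ const 𝟙) A
σ≡id⊛𝟙 A = ∑-cong (divPairs A) (λ {dq} _ → sym (*-identityʳ (proj₁ dq)))

σ-multiplicative : Multiplicative σ
σ-multiplicative M N M≢𝟘 N≢𝟘 M⊥N = begin
  σ (M * N)                       ≡⟨ σ≡id⊛𝟙 (M * N) ⟩
  (id ⊛ const 𝟙) (M * N)
    ≡⟨ ⊛-multiplicative {id} {const 𝟙} (λ _ _ _ _ _ → refl) (λ _ _ _ _ _ → refl) M N M≢𝟘 N≢𝟘 M⊥N ⟩
  (id ⊛ const 𝟙) M * (id ⊛ const 𝟙) N ≡⟨ cong₂ _*_ (σ≡id⊛𝟙 M) (σ≡id⊛𝟙 N) ⟨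
  σ M * σ N                       ∎

-- Prime powers

^-+ : ∀ p m n → p ^ (m +ℕ n) ≡ p ^ m * p ^ n
^-+ p zero    n = refl
^-+ p (suc m) n = trans (cong (p *_) (^-+ p m n)) (sym (*-assoc p (p ^ m) (p ^ n)))

^-≢𝟘 : ∀ {p} n → p ≢ 𝟘 → p ^ n ≢ 𝟘
^-≢𝟘 zero    _   ()
^-≢𝟘 (suc n) p≢𝟘 = *-≢𝟘 p≢𝟘 (^-≢𝟘 n p≢𝟘)

splits : ℕ → List (ℕ × ℕ)
splits zero    = (0 , 0) ∷ []
splits (suc e) = (suc e , 0) ∷ map (map₂ suc) (splits e)

splits-unique : ∀ e → Unique (splits e)
splits-unique zero    = [] ∷ []
splits-unique (suc e) =
  All.map⁺ (All.universal (λ _ ()) (splits e)) ∷ Unique.map⁺ map₂-suc-injective (splits-unique e)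
  where
  map₂-suc-injective : ∀ {x y : ℕ × ℕ} → map₂ suc x ≡ map₂ suc y → x ≡ y
  map₂-suc-injective {_ , _} {_ , _} refl = refl

∈-splits⁻ : ∀ {e i j} → (i , j) ∈ splits e → i +ℕ j ≡ e
∈-splits⁻ {zero}  (here refl) = refl
∈-splits⁻ {suc e} (here refl) = cong suc (+ℕ-identityʳ e)
∈-splits⁻ {suc e} (there ij∈) with ∈-map⁻ (map₂ suc) ij∈
... | (i , j) , ij∈′ , refl = trans (+-suc i j) (cong suc (∈-splits⁻ ij∈′))

∈-splits⁺ : ∀ i j → (i , j) ∈ splits (i +ℕ j)
∈-splits⁺ i zero    = subst (λ e → (i , 0) ∈ splits e) (sym (+ℕ-identityʳ i)) (head∈ i)
  where
  head∈ : ∀ i → (i , 0) ∈ splits i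
  head∈ zero    = here refl
  head∈ (suc i) = here refl
∈-splits⁺ i (suc j) =
  subst (λ e → (i , suc j) ∈ splits e) (sym (+-suc i j)) (there (∈-map⁺ (map₂ suc) (∈-splits⁺ i j)))

X∣p⊎X∣𝟙+p : ∀ p → X ∣ p ⊎ X ∣ 𝟙 + p
X∣p⊎X∣𝟙+p p with head p | cons-head-tail p
... | false | p≡ = inj₁ (tail p , sym p≡)
... | true  | p≡ = inj₂ (tail p , trans (cong (𝟙 +_) (sym p≡)) (cons-+ true true 𝟘 (tail p)))

module PrimePower {P} (P-irr : Irreducible P) where

  P≢𝟘 : P ≢ 𝟘
  P≢𝟘 = proj₁ P-irr

  P≢𝟙 : P ≢ 𝟙
  P≢𝟙 = proj₁ (proj₂ P-irr)

  ^-injective : ∀ {i j} → P ^ i ≡ P ^ j → i ≡ j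
  ^-injective {zero}  {zero}  _       = refl
  ^-injective {zero}  {suc j} 𝟙≡PPʲ   = ⊥-elim (P≢𝟙 (*≡𝟙⇒≡𝟙 (sym 𝟙≡PPʲ)))
  ^-injective {suc i} {zero}  PPⁱ≡𝟙   = ⊥-elim (P≢𝟙 (*≡𝟙⇒≡𝟙 PPⁱ≡𝟙))
  ^-injective {suc i} {suc j} PPⁱ≡PPʲ = cong suc (^-injective (*-cancelˡ (P ^ i) (P ^ j) P≢𝟘 PPⁱ≡PPʲ))

  pow-factorisation : ∀ e {D Q} → D * Q ≡ P ^ e → ∃[ i ] ∃[ j ] i +ℕ j ≡ e × D ≡ P ^ i × Q ≡ P ^ j
  pow-factorisation zero {D} {Q} DQ≡𝟙 = 0 , 0 , refl , *≡𝟙⇒≡𝟙 DQ≡𝟙 , *≡𝟙⇒≡𝟙 (trans (*-comm Q D) DQ≡𝟙)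
  pow-factorisation (suc e) {D} {Q} DQ≡PPᵉ with irreducible-∣⊎coprime P-irr D
  ... | inj₁ (D′ , refl)
    with pow-factorisation e {D′} {Q}
           (*-cancelˡ (D′ * Q) (P ^ e) P≢𝟘 (trans (sym (*-assoc P D′ Q)) DQ≡PPᵉ))
  ...   | i , j , refl , refl , refl = suc i , j , refl , refl , refl
  pow-factorisation (suc e) {D} {Q} DQ≡PPᵉ | inj₂ P⊥D
    with coprime-divisor {P} {Q} {D} P⊥D (P ^ e , trans (*-comm Q D) DQ≡PPᵉ)
  ... | Q′ , refl
    with pow-factorisation e {D} {Q′}
           (*-cancelˡ (D * Q′) (P ^ e) P≢𝟘 (trans (x*yz≡y*xz P D Q′) DQ≡PPᵉ))
  ...   | i , j , refl , refl , refl = i , suc j , +-suc i j , refl , refl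

  pow : ℕ × ℕ → Poly × Poly
  pow (i , j) = P ^ i , P ^ j

  pow-Factorisations : ∀ e → Factorisations (P ^ e) (map pow (splits e))
  pow-Factorisations e = record
    { unique   = Unique.map⁺ pow-injective (splits-unique e)
    ; complete = mk⇔ sound complete⁺
    }
    where
    pow-injective : ∀ {x y} → pow x ≡ pow y → x ≡ y
    pow-injective {_ , _} {_ , _} eq =
      cong₂ _,_ (^-injective (cong proj₁ eq)) (^-injective (cong proj₂ eq))
    sound : ∀ {dq} → dq ∈ map pow (splits e) → uncurry _*_ dq ≡ P ^ e
    sound dq∈ with ∈-map⁻ pow dq∈
    ... | (i , j) , ij∈ , refl = trans (sym (^-+ P i j)) (cong (P ^_) (∈-splits⁻ ij∈))
    complete⁺ : ∀ {dq} → uncurry _*_ dq ≡ P ^ e → dq ∈ map pow (splits e)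
    complete⁺ {D , Q} DQ≡Pᵉ with pow-factorisation e {D} {Q} DQ≡Pᵉ
    ... | i , j , i+j≡e , refl , refl =
      subst (λ e → pow (i , j) ∈ map pow (splits e)) i+j≡e (∈-map⁺ pow (∈-splits⁺ i j))

  ∑-divPairs-pow : ∀ (h : Poly × Poly → Poly) e → ∑ h (divPairs (P ^ e)) ≡ ∑ (h ∘ pow) (splits e)
  ∑-divPairs-pow h e =
    trans (∑-Factorisations h (divPairs-Factorisations (^-≢𝟘 e P≢𝟘)) (pow-Factorisations e))
          (∑-map h pow (splits e))

  geometric : ℕ → Poly
  geometric zero    = 𝟙
  geometric (suc e) = P ^ suc e + geometric e

  σ-pow : ∀ e → σ (P ^ e) ≡ geometric e
  σ-pow e = trans (∑-divPairs-pow proj₁ e) (∑-first e)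
    where
    ∑-first : ∀ e → ∑ (λ ij → P ^ proj₁ ij) (splits e) ≡ geometric e
    ∑-first zero    = refl
    ∑-first (suc e) =
      cong (P ^ suc e +_) (trans (∑-map (λ ij → P ^ proj₁ ij) (map₂ suc) (splits e)) (∑-first e))

  module _ {φ} (isPhi : IsPhi φ) where
    open IsPhi isPhi

    δ : ℕ → Poly
    δ zero    = 𝟙
    δ (suc _) = 𝟘

    φ-pow-suc : ∀ j → φ (P ^ suc j) ≡ P * φ (P ^ j) + δ j
    φ-pow-suc zero    = trans (φ-prime P 0 P-irr) (cong (λ z → P * z + 𝟙) (sym φ-one))
    φ-pow-suc (suc j) = begin
      φ (P ^ suc (suc j))           ≡⟨ φ-prime P (suc j) P-irr ⟩
      P ^ suc (suc j) + P ^ suc j   ≡⟨ *-distribˡ-+ P (P ^ suc j) (P ^ j) ⟨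
      P * (P ^ suc j + P ^ j)       ≡⟨ cong (P *_) (φ-prime P j P-irr) ⟨
      P * φ (P ^ suc j)             ≡⟨ +-identityʳ _ ⟨
      P * φ (P ^ suc j) + 𝟘         ∎

    σ⊛φ-sum : ℕ → Poly
    σ⊛φ-sum e = ∑ (λ ij → geometric (proj₁ ij) * φ (P ^ proj₂ ij)) (splits e)

    σ⊛φ-pow : ∀ e → (σ ⊛ φ) (P ^ e) ≡ σ⊛φ-sum e
    σ⊛φ-pow e = trans (∑-divPairs-pow (λ dq → σ (proj₁ dq) * φ (proj₂ dq)) e)
                      (∑-cong (splits e) (λ {ij} _ → cong (_* φ (P ^ proj₂ ij)) (σ-pow (proj₁ ij))))

    ∑-geometric-δ : ∀ e → ∑ (λ ij → geometric (proj₁ ij) * δ (proj₂ ij)) (splits e) ≡ geometric e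
    ∑-geometric-δ zero    = refl
    ∑-geometric-δ (suc e) = begin
      gₑ₊₁ * 𝟙 + ∑ g (map (map₂ suc) (splits e))
        ≡⟨ cong₂ _+_ (*-identityʳ gₑ₊₁) (∑-map g (map₂ suc) (splits e)) ⟩
      gₑ₊₁ + ∑ (g ∘ map₂ suc) (splits e)          ≡⟨ cong (gₑ₊₁ +_) (∑-cong (splits e) g-shifted≡𝟘) ⟩
      gₑ₊₁ + ∑ (λ _ → 𝟘) (splits e)               ≡⟨ cong (gₑ₊₁ +_) (∑-𝟘 (splits e)) ⟩
      gₑ₊₁ + 𝟘                                    ≡⟨ +-identityʳ gₑ₊₁ ⟩
      gₑ₊₁                                        ∎
      where
      gₑ₊₁ = geometric (suc e)
      g = λ ij → geometric (proj₁ ij) * δ (proj₂ ij)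
      g-shifted≡𝟘 : ∀ {ij} → ij ∈ splits e → g (map₂ suc ij) ≡ 𝟘
      g-shifted≡𝟘 {i , _} _ = *-zeroʳ (geometric i)

    σ⊛φ-sum-suc : ∀ e → σ⊛φ-sum (suc e) ≡ P ^ suc e + P * σ⊛φ-sum e
    σ⊛φ-sum-suc e = begin
      gₑ₊₁ * φ 𝟙 + ∑ t (map (map₂ suc) (splits e))
        ≡⟨ cong₂ _+_ (trans (cong (gₑ₊₁ *_) φ-one) (*-identityʳ gₑ₊₁)) (∑-map t (map₂ suc) (splits e)) ⟩
      gₑ₊₁ + ∑ (t ∘ map₂ suc) (splits e)
        ≡⟨ cong (gₑ₊₁ +_) (∑-cong (splits e) (λ {ij} _ → split-term ij)) ⟩
      gₑ₊₁ + ∑ (λ ij → P * t ij + g ij) (splits e)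
        ≡⟨ cong (gₑ₊₁ +_) (∑-+ (λ ij → P * t ij) g (splits e)) ⟩
      gₑ₊₁ + (∑ (λ ij → P * t ij) (splits e) + ∑ g (splits e))
        ≡⟨ cong (gₑ₊₁ +_) (cong₂ _+_ (∑-*ˡ P t (splits e)) (∑-geometric-δ e)) ⟩
      (P ^ suc e + geometric e) + (P * σ⊛φ-sum e + geometric e)
        ≡⟨ +-interchange (P ^ suc e) (geometric e) (P * σ⊛φ-sum e) (geometric e) ⟩
      (P ^ suc e + P * σ⊛φ-sum e) + (geometric e + geometric e)
        ≡⟨ cong ((P ^ suc e + P * σ⊛φ-sum e) +_) (x+x≡𝟘 (geometric e)) ⟩
      (P ^ suc e + P * σ⊛φ-sum e) + 𝟘
        ≡⟨ +-identityʳ _ ⟩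
      P ^ suc e + P * σ⊛φ-sum e ∎
      where
      gₑ₊₁ = geometric (suc e)
      t = λ ij → geometric (proj₁ ij) * φ (P ^ proj₂ ij)
      g = λ ij → geometric (proj₁ ij) * δ (proj₂ ij)
      split-term : ∀ ij → t (map₂ suc ij) ≡ P * t ij + g ij
      split-term (i , j) = begin
        gᵢ * φ (P ^ suc j)              ≡⟨ cong (gᵢ *_) (φ-pow-suc j) ⟩
        gᵢ * (P * φ (P ^ j) + δ j)      ≡⟨ *-distribˡ-+ gᵢ _ (δ j) ⟩
        gᵢ * (P * φ (P ^ j)) + gᵢ * δ j ≡⟨ cong (_+ gᵢ * δ j) (x*yz≡y*xz gᵢ P _) ⟩
        P * (gᵢ * φ (P ^ j)) + gᵢ * δ j ∎
        where
        gᵢ = geometric i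

    σ⊛φ-sum-suc-suc : ∀ e → σ⊛φ-sum (suc (suc e)) ≡ P * (P * σ⊛φ-sum e)
    σ⊛φ-sum-suc-suc e = begin
      σ⊛φ-sum (suc (suc e))                 ≡⟨ σ⊛φ-sum-suc (suc e) ⟩
      Pᵉ⁺² + P * σ⊛φ-sum (suc e)            ≡⟨ cong (λ z → Pᵉ⁺² + P * z) (σ⊛φ-sum-suc e) ⟩
      Pᵉ⁺² + P * (P ^ suc e + P * σ⊛φ-sum e) ≡⟨ cong (Pᵉ⁺² +_) (*-distribˡ-+ P (P ^ suc e) _) ⟩
      Pᵉ⁺² + (Pᵉ⁺² + P * (P * σ⊛φ-sum e))   ≡⟨ +-assoc Pᵉ⁺² Pᵉ⁺² _ ⟨
      (Pᵉ⁺² + Pᵉ⁺²) + P * (P * σ⊛φ-sum e)   ≡⟨ cong (_+ P * (P * σ⊛φ-sum e)) (x+x≡𝟘 Pᵉ⁺²) ⟩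
      P * (P * σ⊛φ-sum e)                   ∎
      where
      Pᵉ⁺² = P ^ suc (suc e)

    -- The sum is P ^ e for even e and 𝟘 for odd e; for odd e, 𝟙 + P divides the geometric sum instead.
    σ⊛φ-sum≡pow⊎𝟙+P∣geometric : ∀ e → σ⊛φ-sum e ≡ P ^ e ⊎ (𝟙 + P) ∣ geometric e
    σ⊛φ-sum≡pow⊎𝟙+P∣geometric zero          = inj₁ (trans (+-identityʳ (φ 𝟙)) φ-one)
    σ⊛φ-sum≡pow⊎𝟙+P∣geometric (suc zero)    =
      inj₂ (𝟙 , trans (cong (_+ 𝟙) (*-identityʳ P)) (trans (+-comm P 𝟙) (sym (*-identityʳ (𝟙 + P)))))
    σ⊛φ-sum≡pow⊎𝟙+P∣geometric (suc (suc e)) with σ⊛φ-sum≡pow⊎𝟙+P∣geometric e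
    ... | inj₁ sumₑ≡Pᵉ  = inj₁ (trans (σ⊛φ-sum-suc-suc e) (cong (λ z → P * (P * z)) sumₑ≡Pᵉ))
    ... | inj₂ (W , gₑ≡) = inj₂ (P ^ suc e + W , (begin
      P ^ suc (suc e) + (P ^ suc e + geometric e) ≡⟨ +-assoc (P ^ suc (suc e)) (P ^ suc e) _ ⟨
      (P ^ suc (suc e) + P ^ suc e) + geometric e ≡⟨ cong₂ _+_ leading gₑ≡ ⟩
      (𝟙 + P) * P ^ suc e + (𝟙 + P) * W           ≡⟨ *-distribˡ-+ (𝟙 + P) (P ^ suc e) W ⟨
      (𝟙 + P) * (P ^ suc e + W)                   ∎))
      where
      leading : P ^ suc (suc e) + P ^ suc e ≡ (𝟙 + P) * P ^ suc e
      leading = trans (+-comm (P ^ suc (suc e)) (P ^ suc e)) (sym (*-distribʳ-+ 𝟙 P (P ^ suc e)))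

    σ⊛φ-pow-fixed : ∀ e → ¬ X ∣ P → ¬ X ∣ σ (P ^ e) → (σ ⊛ φ) (P ^ e) ≡ P ^ e
    σ⊛φ-pow-fixed e X∤P X∤σPᵉ with σ⊛φ-sum≡pow⊎𝟙+P∣geometric e
    ... | inj₁ sumₑ≡Pᵉ = trans (σ⊛φ-pow e) sumₑ≡Pᵉ
    ... | inj₂ 𝟙+P∣gₑ with X∣p⊎X∣𝟙+p P
    ...   | inj₁ X∣P   = ⊥-elim (X∤P X∣P)
    ...   | inj₂ X∣𝟙+P =
      ⊥-elim (X∤σPᵉ (subst (X ∣_) (sym (σ-pow e)) (∣-trans {X} {𝟙 + P} X∣𝟙+P 𝟙+P∣gₑ)))

∣-dec : ∀ {A} → A ≢ 𝟘 → ∀ D → Dec (D ∣ A)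
∣-dec {A} A≢𝟘 D with any? (λ dq → proj₁ dq ≟ D) (divPairs A)
... | yes found = yes (witness (find found))
  where
  witness : ∃[ dq ] dq ∈ divPairs A × proj₁ dq ≡ D → D ∣ A
  witness ((_ , Q) , dq∈ , refl) = Q , sym (∈-divPairs⁻ A≢𝟘 dq∈)
... | no  none  = no λ (Q , A≡DQ) → none (lose (∈-divPairs⁺ A≢𝟘 (sym A≡DQ)) refl)

irreducible⊎factors : ∀ {A} → A ≢ 𝟘 → A ≢ 𝟙 →
  Irreducible A ⊎ ∃[ D ] ∃[ Q ] D * Q ≡ A × D ≢ 𝟙 × Q ≢ 𝟙
irreducible⊎factors {A} A≢𝟘 A≢𝟙 with any? nontrivial? (divPairs A)
  where
  nontrivial? = λ (dq : Poly × Poly) → ¬? (proj₁ dq ≟ 𝟙) ×-dec ¬? (proj₂ dq ≟ 𝟙)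
... | yes found with find found
...   | (D , Q) , dq∈ , D≢𝟙 , Q≢𝟙 = inj₂ (D , Q , ∈-divPairs⁻ A≢𝟘 dq∈ , D≢𝟙 , Q≢𝟙)
irreducible⊎factors {A} A≢𝟘 A≢𝟙 | no none = inj₁ (A≢𝟘 , A≢𝟙 , trivial)
  where
  trivial : ∀ B C → A ≡ B * C → B ≡ 𝟙 ⊎ C ≡ 𝟙
  trivial B C A≡BC with B ≟ 𝟙 | C ≟ 𝟙
  ... | yes B≡𝟙 | _       = inj₁ B≡𝟙
  ... | no  _   | yes C≡𝟙 = inj₂ C≡𝟙
  ... | no  B≢𝟙 | no  C≢𝟙 = ⊥-elim (none (lose (∈-divPairs⁺ A≢𝟘 (sym A≡BC)) (B≢𝟙 , C≢𝟙)))

irreducible-factor : ∀ {A} → A ≢ 𝟘 → A ≢ 𝟙 → ∃[ P ] Irreducible P × P ∣ A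
irreducible-factor {A} = size-rec (λ A → A ≢ 𝟘 → A ≢ 𝟙 → ∃[ P ] Irreducible P × P ∣ A) step A
  where
  step : ∀ A → (∀ {B} → size B < size A → B ≢ 𝟘 → B ≢ 𝟙 → ∃[ P ] Irreducible P × P ∣ B) →
         A ≢ 𝟘 → A ≢ 𝟙 → ∃[ P ] Irreducible P × P ∣ A
  step A rec A≢𝟘 A≢𝟙 with irreducible⊎factors A≢𝟘 A≢𝟙
  ... | inj₁ A-irr = A , A-irr , ∣-refl {A}
  ... | inj₂ (D , Q , refl , D≢𝟙 , Q≢𝟙) with rec (size<size-*ˡ D≢𝟘 Q≢𝟘 Q≢𝟙) D≢𝟘 D≢𝟙
    where
    D≢𝟘 = *≢𝟘⇒≢𝟘ˡ D Q A≢𝟘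
    Q≢𝟘 = *≢𝟘⇒≢𝟘ʳ D Q A≢𝟘
  ... | P , P-irr , P∣D = P , P-irr , ∣m⇒∣m*n {P} {D} Q P∣D

pow-split : ∀ {P} → Irreducible P → ∀ {A} → A ≢ 𝟘 → ∃[ e ] ∃[ B ] A ≡ P ^ e * B × ¬ P ∣ B
pow-split {P} (P≢𝟘 , P≢𝟙 , _) {A} =
  size-rec (λ A → A ≢ 𝟘 → ∃[ e ] ∃[ B ] A ≡ P ^ e * B × ¬ P ∣ B) step A
  where
  step : ∀ A → (∀ {A′} → size A′ < size A → A′ ≢ 𝟘 → ∃[ e ] ∃[ B ] A′ ≡ P ^ e * B × ¬ P ∣ B) →
         A ≢ 𝟘 → ∃[ e ] ∃[ B ] A ≡ P ^ e * B × ¬ P ∣ B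
  step A rec A≢𝟘 with ∣-dec A≢𝟘 P
  ... | no  P∤A          = 0 , A , refl , P∤A
  ... | yes (A′ , refl) with rec (size<size-*ʳ P≢𝟘 A′≢𝟘 P≢𝟙) A′≢𝟘
    where
    A′≢𝟘 = *≢𝟘⇒≢𝟘ʳ P A′ A≢𝟘
  ... | e , B , refl , P∤B = suc e , B , sym (*-assoc P (P ^ e) B) , P∤B

coprime-pow : ∀ {P B} → Irreducible P → ¬ P ∣ B → ∀ e → Coprime (P ^ e) B
coprime-pow {P} P-irr P∤B e D (k , Pᵉ≡Dk) D∣B with PrimePower.pow-factorisation P-irr e (sym Pᵉ≡Dk)
... | zero  , _ , _ , D≡𝟙 , _ = D≡𝟙
... | suc i , _ , _ , refl , _ = ⊥-elim (P∤B (∣-trans {P} {P ^ suc i} (m∣m*n P (P ^ i)) D∣B))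

multiplicative-induction : (Q : Poly → Set) → Q 𝟙 →
  (∀ {P} e → Irreducible P → Q (P ^ suc e)) →
  (∀ {M N} → M ≢ 𝟘 → N ≢ 𝟘 → Coprime M N → Q M → Q N → Q (M * N)) →
  ∀ {A} → A ≢ 𝟘 → Q A
multiplicative-induction Q Q𝟙 Q-pow Q-* {A} = size-rec (λ A → A ≢ 𝟘 → Q A) step A
  where
  step : ∀ A → (∀ {B} → size B < size A → B ≢ 𝟘 → Q B) → A ≢ 𝟘 → Q A
  step A rec A≢𝟘 with A ≟ 𝟙
  ... | yes refl = Q𝟙
  ... | no  A≢𝟙 with irreducible-factor A≢𝟘 A≢𝟙
  ... | P , P-irr , P∣A with pow-split P-irr A≢𝟘
  ...   | zero  , B , refl , P∤B = ⊥-elim (P∤B P∣A)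
  ...   | suc e , B , refl , P∤B =
    Q-* Pᵉ≢𝟘 B≢𝟘 (coprime-pow P-irr P∤B (suc e)) (Q-pow e P-irr) (rec (size<size-*ʳ Pᵉ≢𝟘 B≢𝟘 Pᵉ≢𝟙) B≢𝟘)
    where
    Pᵉ≢𝟘 = *≢𝟘⇒≢𝟘ˡ (P ^ suc e) B A≢𝟘
    B≢𝟘  = *≢𝟘⇒≢𝟘ʳ (P ^ suc e) B A≢𝟘
    Pᵉ≢𝟙 : P ^ suc e ≢ 𝟙
    Pᵉ≢𝟙 = proj₁ (proj₂ P-irr) ∘ *≡𝟙⇒≡𝟙

-- Odd perfect polynomials

X-irreducible : Irreducible X
X-irreducible = (λ ()) , (λ ()) , factors
  where
  factors : ∀ B C → X ≡ B * C → B ≡ 𝟙 ⊎ C ≡ 𝟙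
  factors B C X≡BC =
    degrees (deg B) (deg C) refl refl (trans (sym (deg-* B≢𝟘 C≢𝟘)) (cong deg (sym X≡BC)))
    where
    BC≢𝟘 : B * C ≢ 𝟘
    BC≢𝟘 BC≡𝟘 with trans X≡BC BC≡𝟘
    ... | ()
    B≢𝟘 = *≢𝟘⇒≢𝟘ˡ B C BC≢𝟘
    C≢𝟘 = *≢𝟘⇒≢𝟘ʳ B C BC≢𝟘
    degrees : ∀ m n → deg B ≡ m → deg C ≡ n → m +ℕ n ≡ 1 → B ≡ 𝟙 ⊎ C ≡ 𝟙
    degrees zero          _       deg-B _     _  = inj₁ (deg≡0⇒≡𝟙 B≢𝟘 deg-B)
    degrees (suc zero)    zero    _     deg-C _  = inj₂ (deg≡0⇒≡𝟙 C≢𝟘 deg-C)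
    degrees (suc zero)    (suc _) _     _     ()
    degrees (suc (suc _)) _       _     _     ()

σ⊛φ-fixed : ∀ {φ} → IsPhi φ → ∀ {A} → A ≢ 𝟘 → ¬ X ∣ A → ¬ X ∣ σ A → (σ ⊛ φ) A ≡ A
σ⊛φ-fixed {φ} isPhi =
  multiplicative-induction Fixed (λ _ _ → trans (+-identityʳ (φ 𝟙)) φ-one) fixed-pow fixed-*
  where
  open IsPhi isPhi
  Fixed : Poly → Set
  Fixed A = ¬ X ∣ A → ¬ X ∣ σ A → (σ ⊛ φ) A ≡ A
  fixed-pow : ∀ {P} e → Irreducible P → Fixed (P ^ suc e)
  fixed-pow {P} e P-irr X∤Pᵉ X∤σPᵉ =
    PrimePower.σ⊛φ-pow-fixed P-irr isPhi (suc e) (X∤Pᵉ ∘ ∣m⇒∣m*n {X} {P} (P ^ e)) X∤σPᵉ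
  fixed-* : ∀ {M N} → M ≢ 𝟘 → N ≢ 𝟘 → Coprime M N → Fixed M → Fixed N → Fixed (M * N)
  fixed-* {M} {N} M≢𝟘 N≢𝟘 M⊥N fixed-M fixed-N X∤MN X∤σMN = begin
    (σ ⊛ φ) (M * N)       ≡⟨ ⊛-multiplicative {σ} {φ} σ-multiplicative φ-mult M N M≢𝟘 N≢𝟘 M⊥N ⟩
    (σ ⊛ φ) M * (σ ⊛ φ) N ≡⟨ cong₂ _*_ (fixed-M (X∤MN ∘ ∣m⇒∣m*n {X} {M} N) (X∤σMN ∘ X∣σM⇒X∣σMN))
                                       (fixed-N (X∤MN ∘ ∣n⇒∣m*n {X} {N} M) (X∤σMN ∘ X∣σN⇒X∣σMN)) ⟩
    M * N                 ∎
    where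
    σMN≡σMσN = σ-multiplicative M N M≢𝟘 N≢𝟘 M⊥N
    X∣σM⇒X∣σMN : X ∣ σ M → X ∣ σ (M * N)
    X∣σM⇒X∣σMN X∣σM = subst (X ∣_) (sym σMN≡σMσN) (∣m⇒∣m*n {X} {σ M} (σ N) X∣σM)
    X∣σN⇒X∣σMN : X ∣ σ N → X ∣ σ (M * N)
    X∣σN⇒X∣σMN X∣σN = subst (X ∣_) (sym σMN≡σMσN) (∣n⇒∣m*n {X} {σ N} (σ M) X∣σN)

properDivisor? : ∀ A (dq : Poly × Poly) → Dec (proj₁ dq ≢ 𝟙 × proj₁ dq ≢ A)
properDivisor? A dq = ¬? (proj₁ dq ≟ 𝟙) ×-dec ¬? (proj₁ dq ≟ A)

∑-trivialFactorisations : ∀ {A} → A ≢ 𝟘 → A ≢ 𝟙 → (h : Poly × Poly → Poly) →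
  ∑ h (filter (∁? (properDivisor? A)) (divPairs A)) ≡ h (𝟙 , A) + h (A , 𝟙)
∑-trivialFactorisations {A} A≢𝟘 A≢𝟙 h = begin
  ∑ h (filter trivial? (divPairs A)) ≡⟨ ∑-set h filter-unique trivial-unique (mk⇔ sound complete) ⟩
  h (𝟙 , A) + (h (A , 𝟙) + 𝟘)        ≡⟨ cong (h (𝟙 , A) +_) (+-identityʳ (h (A , 𝟙))) ⟩
  h (𝟙 , A) + h (A , 𝟙)              ∎
  where
  trivial? = ∁? (properDivisor? A)
  trivial = (𝟙 , A) ∷ (A , 𝟙) ∷ []
  filter-unique : Unique (filter trivial? (divPairs A))
  filter-unique = Unique.filter⁺ trivial? (Factorisations.unique (divPairs-Factorisations A≢𝟘))
  trivial-unique : Unique trivial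
  trivial-unique = ((λ eq → A≢𝟙 (sym (cong proj₁ eq))) ∷ []) ∷ [] ∷ []
  sound : ∀ {dq} → dq ∈ filter trivial? (divPairs A) → dq ∈ trivial
  sound {D , Q} dq∈ with ∈-filter⁻ trivial? {xs = divPairs A} dq∈
  ... | dq∈′ , not-proper with D ≟ 𝟙 | D ≟ A
  ...   | yes refl | _        = here (cong (𝟙 ,_) (∈-divPairs⁻ A≢𝟘 dq∈′))
  ...   | no  _    | yes refl =
    there (here (cong (A ,_) (cofactor-unique {d = A} A≢𝟘 (∈-divPairs⁻ A≢𝟘 dq∈′) (*-identityʳ A))))
  ...   | no  D≢𝟙  | no  D≢A  = ⊥-elim (not-proper (D≢𝟙 , D≢A))
  complete : ∀ {dq} → dq ∈ trivial → dq ∈ filter trivial? (divPairs A)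
  complete (here refl)         =
    ∈-filter⁺ trivial? (∈-divPairs⁺ A≢𝟘 refl) (λ proper → proj₁ proper refl)
  complete (there (here refl)) =
    ∈-filter⁺ trivial? (∈-divPairs⁺ A≢𝟘 (*-identityʳ A)) (λ proper → proj₂ proper refl)

corollary3p16 : (φ : Poly → Poly) → IsPhi φ → (A : Poly) →
    Odd A → 1 ≤ deg A → Perfect A →
    φ A ≡ properDivisorSum φ A
corollary3p16 φ isPhi A (A≢𝟘 , no-linear-factor) 1≤deg-A σA≡A =
  +-cancelʳ A (trans (x≡y+z⇒z≡x+y A≡proper+φA+A) (+-comm A (properDivisorSum φ A)))
  where
  open IsPhi isPhi
  h : Poly × Poly → Poly
  h dq = σ (proj₁ dq) * φ (proj₂ dq)
  A≢𝟙 : A ≢ 𝟙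
  A≢𝟙 refl = <-irrefl refl 1≤deg-A
  X∤A : ¬ X ∣ A
  X∤A = no-linear-factor X X-irreducible refl
  X∤σA : ¬ X ∣ σ A
  X∤σA = subst (λ B → ¬ X ∣ B) (sym σA≡A) X∤A
  A≡proper+φA+A : A ≡ properDivisorSum φ A + (φ A + A)
  A≡proper+φA+A = begin
    A                                        ≡⟨ σ⊛φ-fixed isPhi A≢𝟘 X∤A X∤σA ⟨
    (σ ⊛ φ) A                                ≡⟨ ∑-filter h (properDivisor? A) (divPairs A) ⟩
    properDivisorSum φ A + ∑ h (filter (∁? (properDivisor? A)) (divPairs A))
      ≡⟨ cong (properDivisorSum φ A +_) (∑-trivialFactorisations A≢𝟘 A≢𝟙 h) ⟩
    properDivisorSum φ A + (φ A + σ A * φ 𝟙) ≡⟨ cong (λ z → properDivisorSum φ A + (φ A + z)) σA*φ𝟙≡A ⟩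
    properDivisorSum φ A + (φ A + A)         ∎
    where
    σA*φ𝟙≡A : σ A * φ 𝟙 ≡ A
    σA*φ𝟙≡A = trans (cong₂ _*_ σA≡A φ-one) (*-identityʳ A)
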